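{- Let $v\equiv 3\pmod 4$ and suppose $v$ satisfies none of the following: (i) $v\equiv 3\pmod{12}$ and $v=3^{2a}v_1$ with $a\ge1$, $3\nmid v_1$; (ii) $v\equiv 15\pmod{36}$ and $v=3p_1\cdots p_s$ with the $p_i$ distinct primes, each $p_i\equiv\pm3\pmod 8$; (iii) $v\equiv 7,11\pmod{12}$ and $v=p_1\cdots p_t$ with the $p_i$ distinct primes, each $p_i\equiv\pm3\pmod8$. Then: (1) if $v\equiv 3\pmod{12}$, there exist $\alpha,\beta\in\mathbb{Z}_v$, both nonzero modulo $v$, such that $2\alpha^2-\beta^2\equiv v/3\pmod v$; (2) if $v\equiv 7,11\pmod{12}$, there exist $\alpha,\beta$, both nonzero modulo $v$, such that $2\alpha^2-\beta^2\equiv 0\pmod v$. -}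

module Defs where

open import Data.Nat using (ℕ; _%_; _/_; _^_; _*_; _≥_)
open import Data.Nat.Divisibility using (_∣_)
open import Data.Nat.Primality using (Prime)
open import Data.Integer as ℤ using (ℤ; +_)
open import Data.Integer.Divisibility as ℤD using ()
open import Data.List using (List)
open import Data.Nat.ListAction using (product)
open import Data.List.Relation.Unary.All using (All)
open import Data.List.Relation.Unary.Unique.Propositional using (Unique)
open import Data.Product using (Σ; ∃; _×_)
open import Data.Sum using (_⊎_)
open import Relation.Nullary using (¬_)
open import Relation.Binary.PropositionalEquality using (_≡_)

PlusMinus3Mod8 : ℕ → Set
PlusMinus3Mod8 p = (p % 8 ≡ 3) ⊎ (p % 8 ≡ 5)

Is7or11Mod12 : ℕ → Set
Is7or11Mod12 v = (v % 12 ≡ 7) ⊎ (v % 12 ≡ 11)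

GoodPrimes : List ℕ → Set
GoodPrimes ps = Unique ps × All Prime ps × All PlusMinus3Mod8 ps

ExcI : ℕ → Set
ExcI v = (v % 12 ≡ 3) ×
  ∃ λ a → ∃ λ v₁ → (a ≥ 1) × ¬ (3 ∣ v₁) × (v ≡ 3 ^ (2 * a) * v₁)

ExcII : ℕ → Set
ExcII v = (v % 36 ≡ 15) × ∃ λ ps → GoodPrimes ps × (v ≡ 3 * product ps)

ExcIII : ℕ → Set
ExcIII v = Is7or11Mod12 v × ∃ λ ps → GoodPrimes ps × (v ≡ product ps)

_≡_[mod_] : ℤ → ℤ → ℕ → Set
x ≡ y [mod v ] = (+ v) ℤD.∣ (x ℤ.- y)

form : ℤ → ℤ → ℤ
form α β = (+ 2) ℤ.* (α ℤ.* α) ℤ.- β ℤ.* β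

-- Excluding (ii) and (iii) yields, via the prime
-- factorisation, a prime q dividing the relevant cofactor n (n = v, resp. n = v/3) with q² ∣ n or
-- q ≡ ±1 (mod 8).  If q² ∣ v, then α = β = v/q works.  If q ≡ ±1 (mod 8), then 2 ≡ y² (mod q):
-- otherwise pairing each residue z with 2/z gives (q−1)! ≡ 2^((q−1)/2), which is −1 by Wilson's
-- theorem but 1 by Gauss's lemma; then α = v/q, β = y·v/q works, as 2α² − β² = −(v/q)²(y² − 2).
-- For v ≡ 3 (mod 12) write v = 3w²u with w a power of 3 and 3 ∤ u (an even power of 3 is
-- exception (i)).  Then α = β = wu works if u ≡ 1 (mod 3), and α = wu, β = 3wu if u ≡ 2 and w > 1,
-- since 2α² − β² − w²u is w²u(u − 1), resp. −w²u(7u + 1).  If u ≡ 2 and w = 1, then v ≡ 15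
-- (mod 36), so (ii) yields q as above for u, and α = u/q, β = 3s·u/q with 9s² ≡ 2 (mod q) (s = 1 if
-- q² ∣ u) works: 2α² − β² − u = −u(F + 1) where Fq = (u/q)(9s² − 2), and F ≡ 2 (mod 3).

module Submission where

open import Defs
open import Data.Nat using (ℕ; _%_; _/_)
open import Data.Integer using (ℤ; +_; 0ℤ)
open import Data.Product using (∃; _×_)
open import Relation.Nullary using (¬_)
open import Relation.Binary.PropositionalEquality using (_≡_)
open import Data.Nat using (zero; suc)
open import Data.Nat.Primality using (Prime)
open import Data.Product using (_,_)

module Congruence (m : ℤ) where

  open import Data.Integer using (_+_; _*_; _-_; -_)
  open import Data.Integer.Divisibility.Signed
    using (_∣_; _∣?_; divides; ∣m∣n⇒∣m+n; ∣m⇒∣-m; ∣n⇒∣m*n; ∣m⇒∣m*n)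
  open import Data.Integer.Properties using (+-identityʳ)
  open import Data.Integer.Tactic.RingSolver using (solve)
  open import Data.List using ([]; _∷_)
  open import Level using (0ℓ)
  open import Relation.Binary.Bundles using (Setoid)
  open import Relation.Binary.Structures using (IsEquivalence)
  open import Relation.Binary.Definitions using (Decidable)
  open import Relation.Nullary.Decidable using (map′)
  open import Relation.Binary.PropositionalEquality using (refl; sym; subst)
  import Relation.Binary.Reasoning.Setoid

  infix 4 _≈_ _≉_ _≈?_

  -- A record rather than a synonym for m ∣ x - y, so that x and y can be inferred.
  record _≈_ (x y : ℤ) : Set where
    constructor mk
    field modulus∣difference : m ∣ x - y

  open _≈_ public

  _≉_ : ℤ → ℤ → Set
  x ≉ y = ¬ (x ≈ y)

  ≈-reflexive : ∀ {x y} → x ≡ y → x ≈ y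
  ≈-reflexive {x} refl = mk (divides 0ℤ x-x≡0*m)
    where
    x-x≡0*m : x - x ≡ 0ℤ * m
    x-x≡0*m = solve (x ∷ m ∷ [])

  ≈-refl : ∀ {x} → x ≈ x
  ≈-refl = ≈-reflexive refl

  ≈-sym : ∀ {x y} → x ≈ y → y ≈ x
  ≈-sym {x} {y} (mk d) = mk (subst (m ∣_) eq (∣m⇒∣-m d))
    where
    eq : - (x - y) ≡ y - x
    eq = solve (x ∷ y ∷ [])

  ≈-trans : ∀ {x y z} → x ≈ y → y ≈ z → x ≈ z
  ≈-trans {x} {y} {z} (mk d) (mk e) = mk (subst (m ∣_) eq (∣m∣n⇒∣m+n d e))
    where
    eq : (x - y) + (y - z) ≡ x - z
    eq = solve (x ∷ y ∷ z ∷ [])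

  _≈?_ : Decidable _≈_
  x ≈? y = map′ mk modulus∣difference (m ∣? x - y)

  ≈-isEquivalence : IsEquivalence _≈_
  ≈-isEquivalence = record { refl = ≈-refl ; sym = ≈-sym ; trans = ≈-trans }

  ≈-setoid : Setoid 0ℓ 0ℓ
  ≈-setoid = record { isEquivalence = ≈-isEquivalence }

  module ≈-Reasoning = Relation.Binary.Reasoning.Setoid ≈-setoid

  +-cong : ∀ {x x′ y y′} → x ≈ x′ → y ≈ y′ → x + y ≈ x′ + y′
  +-cong {x} {x′} {y} {y′} (mk d) (mk e) = mk (subst (m ∣_) eq (∣m∣n⇒∣m+n d e))
    where
    eq : (x - x′) + (y - y′) ≡ (x + y) - (x′ + y′)
    eq = solve (x ∷ x′ ∷ y ∷ y′ ∷ [])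

  -‿cong : ∀ {x x′} → x ≈ x′ → - x ≈ - x′
  -‿cong {x} {x′} (mk d) = mk (subst (m ∣_) eq (∣m⇒∣-m d))
    where
    eq : - (x - x′) ≡ - x - - x′
    eq = solve (x ∷ x′ ∷ [])

  *-cong : ∀ {x x′ y y′} → x ≈ x′ → y ≈ y′ → x * y ≈ x′ * y′
  *-cong {x} {x′} {y} {y′} (mk d) (mk e) =
    mk (subst (m ∣_) eq (∣m∣n⇒∣m+n (∣n⇒∣m*n x e) (∣m⇒∣m*n y′ d)))
    where
    eq : x * (y - y′) + (x - x′) * y′ ≡ x * y - x′ * y′
    eq = solve (x ∷ x′ ∷ y ∷ y′ ∷ [])

  ∣⇒≈0 : ∀ {x} → m ∣ x → x ≈ 0ℤ
  ∣⇒≈0 {x} d = mk (subst (m ∣_) (sym (+-identityʳ x)) d)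

  ≈0⇒∣ : ∀ {x} → x ≈ 0ℤ → m ∣ x
  ≈0⇒∣ {x} (mk d) = subst (m ∣_) (+-identityʳ x) d

  multiple≈0 : ∀ k → k * m ≈ 0ℤ
  multiple≈0 k = ∣⇒≈0 (divides k refl)

  ≈⇒-≈0 : ∀ {x y} → x ≈ y → x - y ≈ 0ℤ
  ≈⇒-≈0 (mk d) = ∣⇒≈0 d

  -≈0⇒≈ : ∀ {x y} → x - y ≈ 0ℤ → x ≈ y
  -≈0⇒≈ x-y≈0 = mk (≈0⇒∣ x-y≈0)

module PrimeModulus (p : ℕ) (p-prime : Prime p) where

  open import Data.Nat as ℕ using (zero; suc; _<_; _≤_; z≤n; s≤s; NonZero)
  open import Data.Nat.Properties as ℕ using (≤-total; m∸n≡0⇒m≤n; ≤-antisym)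
  import Data.Nat.Divisibility as ℕ
  open import Data.Nat.DivMod using (m<n⇒m%n≡m)
  open import Data.Nat.Primality using (euclidsLemma; prime⇒nonZero; prime⇒nonTrivial)
  open import Data.Nat.Coprimality using (coprime-Bézout; prime⇒coprime)
  open import Data.Nat.GCD using (module Bézout)
  open import Data.Integer using (1ℤ; -1ℤ; _+_; _*_; _-_; -_; ∣_∣)
  open import Data.Integer.Properties using (abs-*; pos-*; *-comm; +-identityʳ; [+m]-[+n]≡m⊖n; ⊖-≥)
  open import Data.Integer.Divisibility.Signed using (∣⇒∣ᵤ; ∣ᵤ⇒∣)
  open import Data.Integer.DivMod using (_%ℕ_; _/ℕ_; a≡a%ℕn+[a/ℕn]*n; n%ℕd<d)
  open import Data.Integer.Tactic.RingSolver using (solve)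
  open import Data.List using ([]; _∷_)
  open import Data.Product using (_,_)
  open import Data.Sum using (_⊎_; inj₁; inj₂)
  open import Data.Empty using (⊥-elim)
  open import Relation.Binary.PropositionalEquality using (sym; trans; cong; subst; module ≡-Reasoning)

  open Congruence (+ p) public

  instance
    p-nonZero : NonZero p
    p-nonZero = prime⇒nonZero p-prime

  1<p : 1 < p
  1<p = ℕ.nonTrivial⇒n>1 p {{prime⇒nonTrivial p-prime}}

  *≈0⇒≈0⊎≈0 : ∀ x y → x * y ≈ 0ℤ → x ≈ 0ℤ ⊎ y ≈ 0ℤ
  *≈0⇒≈0⊎≈0 x y xy≈0
    with euclidsLemma ∣ x ∣ ∣ y ∣ p-prime (subst (p ℕ.∣_) (abs-* x y) (∣⇒∣ᵤ (≈0⇒∣ xy≈0)))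
  ... | inj₁ p∣x = inj₁ (∣⇒≈0 (∣ᵤ⇒∣ p∣x))
  ... | inj₂ p∣y = inj₂ (∣⇒≈0 (∣ᵤ⇒∣ p∣y))

  *-cancelʳ-≈ : ∀ {x y} z → z ≉ 0ℤ → x * z ≈ y * z → x ≈ y
  *-cancelʳ-≈ {x} {y} z z≉0 xz≈yz with *≈0⇒≈0⊎≈0 (x - y) z difference≈0
    where
    open ≈-Reasoning
    difference≈0 : (x - y) * z ≈ 0ℤ
    difference≈0 = begin
      (x - y) * z     ≡⟨ solve (x ∷ y ∷ z ∷ []) ⟩
      x * z - y * z   ≈⟨ ≈⇒-≈0 xz≈yz ⟩
      0ℤ              ∎
  ... | inj₁ x-y≈0 = -≈0⇒≈ x-y≈0
  ... | inj₂ z≈0   = ⊥-elim (z≉0 z≈0)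

  square≈1⇒≈±1 : ∀ x → x * x ≈ 1ℤ → x ≈ 1ℤ ⊎ x ≈ -1ℤ
  square≈1⇒≈±1 x x²≈1 with *≈0⇒≈0⊎≈0 (x - 1ℤ) (x - -1ℤ) factored≈0
    where
    open ≈-Reasoning
    factored≈0 : (x - 1ℤ) * (x - -1ℤ) ≈ 0ℤ
    factored≈0 = begin
      (x - 1ℤ) * (x - -1ℤ) ≡⟨ solve (x ∷ []) ⟩
      x * x - 1ℤ           ≈⟨ ≈⇒-≈0 x²≈1 ⟩
      0ℤ                   ∎
  ... | inj₁ x-1≈0  = inj₁ (-≈0⇒≈ x-1≈0)
  ... | inj₂ x+1≈0  = inj₂ (-≈0⇒≈ x+1≈0)

  residue : ℤ → ℕ
  residue x = x %ℕ p

  residue<p : ∀ x → residue x < p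
  residue<p x = n%ℕd<d x p

  ≈-residue : ∀ x → x ≈ + residue x
  ≈-residue x = begin
    x                                ≡⟨ a≡a%ℕn+[a/ℕn]*n x p ⟩
    + residue x + (x /ℕ p) * + p     ≈⟨ +-cong (≈-refl {+ residue x}) (multiple≈0 (x /ℕ p)) ⟩
    + residue x + 0ℤ                 ≡⟨ +-identityʳ (+ residue x) ⟩
    + residue x                      ∎
    where open ≈-Reasoning

  ≤-residue-unique : ∀ {a b} → a ≤ b → b < p → + b ≈ + a → b ≡ a
  ≤-residue-unique {a} {b} a≤b b<p (mk p∣b-a) =
    ≤-antisym (m∸n≡0⇒m≤n b∸a≡0) a≤b
    where
    p∣b∸a : p ℕ.∣ b ℕ.∸ a
    p∣b∸a = subst (p ℕ.∣_) (cong ∣_∣ (trans ([+m]-[+n]≡m⊖n b a) (⊖-≥ a≤b)))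
                  (∣⇒∣ᵤ p∣b-a)
    b∸a≡0 : b ℕ.∸ a ≡ 0
    b∸a≡0 = trans (sym (m<n⇒m%n≡m (ℕ.≤-<-trans (ℕ.m∸n≤m b a) b<p)))
                  (ℕ.n∣m⇒m%n≡0 _ p p∣b∸a)

  residue-unique : ∀ {a b} → a < p → b < p → + a ≈ + b → a ≡ b
  residue-unique {a} {b} a<p b<p a≈b with ≤-total a b
  ... | inj₁ a≤b = sym (≤-residue-unique a≤b b<p (≈-sym a≈b))
  ... | inj₂ b≤a = ≤-residue-unique b≤a a<p a≈b

  positive-residue≉0 : ∀ {a} → 0 < a → a < p → + a ≉ 0ℤ
  positive-residue≉0 {suc a} _ a<p a≈0 with residue-unique a<p (ℕ.<-trans (s≤s z≤n) a<p) a≈0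
  ... | ()

  1≉0 : 1ℤ ≉ 0ℤ
  1≉0 = positive-residue≉0 (s≤s z≤n) 1<p

  private
    pos-1+*≡* : ∀ a b c d → 1 ℕ.+ a ℕ.* b ≡ c ℕ.* d → 1ℤ + + a * + b ≡ + c * + d
    pos-1+*≡* a b c d eq = begin
      1ℤ + + a * + b     ≡⟨ cong (λ t → 1ℤ + t) (pos-* a b) ⟨
      + (1 ℕ.+ a ℕ.* b)  ≡⟨ cong +_ eq ⟩
      + (c ℕ.* d)        ≡⟨ pos-* c d ⟩
      + c * + d          ∎
      where open ≡-Reasoning

    1+br≡ap⇒r*-b≈1 : ∀ a b r → 1ℤ + b * r ≡ a * + p → r * - b ≈ 1ℤ
    1+br≡ap⇒r*-b≈1 a b r eq = begin
      r * - b             ≡⟨ solve (r ∷ b ∷ []) ⟩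
      1ℤ - (1ℤ + b * r)   ≡⟨ cong (λ t → 1ℤ - t) eq ⟩
      1ℤ - a * + p        ≈⟨ +-cong (≈-refl {1ℤ}) (-‿cong (multiple≈0 a)) ⟩
      1ℤ                  ∎
      where open ≈-Reasoning

    1+ap≡br⇒r*b≈1 : ∀ a b r → 1ℤ + a * + p ≡ b * r → r * b ≈ 1ℤ
    1+ap≡br⇒r*b≈1 a b r eq = begin
      r * b               ≡⟨ *-comm r b ⟩
      b * r               ≡⟨ eq ⟨
      1ℤ + a * + p        ≈⟨ +-cong (≈-refl {1ℤ}) (multiple≈0 a) ⟩
      1ℤ                  ∎
      where open ≈-Reasoning

  inverse : ∀ x → x ≉ 0ℤ → ∃ λ y → x * y ≈ 1ℤ
  inverse x x≉0 with residue x in r≡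
  ... | zero  = ⊥-elim (x≉0 (subst (λ r → x ≈ + r) r≡ (≈-residue x)))
  ... | r@(suc _) = bézout (coprime-Bézout (prime⇒coprime p-prime r<p))
    where
    r<p : r < p
    r<p = subst (_< p) r≡ (residue<p x)
    x≈r : x ≈ + r
    x≈r = subst (λ r → x ≈ + r) r≡ (≈-residue x)
    bézout : Bézout.Identity 1 p r → ∃ λ y → x * y ≈ 1ℤ
    bézout (Bézout.+- a b eq) =
      - + b , ≈-trans (*-cong x≈r ≈-refl)
                      (1+br≡ap⇒r*-b≈1 (+ a) (+ b) (+ r) (pos-1+*≡* b r a p eq))
    bézout (Bézout.-+ a b eq) =
      + b , ≈-trans (*-cong x≈r ≈-refl)
                    (1+ap≡br⇒r*b≈1 (+ a) (+ b) (+ r) (pos-1+*≡* a p b r eq))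

module ListRemoval where

  open import Data.Nat using (_*_)
  open import Data.Nat.Properties using (*-commutativeSemigroup)
  open import Data.Nat.ListAction using (product)
  open import Algebra.Properties.CommutativeSemigroup *-commutativeSemigroup using (x∙yz≈y∙xz)
  open import Data.List using (List; _∷_)
  open import Data.List.Membership.Propositional using (_∈_)
  open import Data.List.Relation.Unary.Any using (here; there; _─_)
  open import Data.List.Relation.Unary.All as All using (All; _∷_)
  open import Data.List.Relation.Unary.All.Properties using (─⁺)
  open import Data.List.Relation.Unary.AllPairs using (AllPairs; _∷_)
  open import Data.Empty using (⊥-elim)
  open import Relation.Binary.Definitions using (Symmetric)
  open import Relation.Binary.PropositionalEquality using (refl; trans; cong; _≢_)

  module _ {A : Set} where

    ∈-─⁻ : ∀ {xs : List A} {w z} (w∈ : w ∈ xs) → z ∈ (xs ─ w∈) → z ∈ xs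
    ∈-─⁻ (here refl) z∈          = there z∈
    ∈-─⁻ (there w∈)  (here refl) = here refl
    ∈-─⁻ (there w∈)  (there z∈)  = there (∈-─⁻ w∈ z∈)

    ∈-─⁺ : ∀ {xs : List A} {w z} (w∈ : w ∈ xs) → z ∈ xs → z ≢ w → z ∈ (xs ─ w∈)
    ∈-─⁺ (here refl) (here refl) z≢w = ⊥-elim (z≢w refl)
    ∈-─⁺ (here refl) (there z∈)  _   = z∈
    ∈-─⁺ (there w∈)  (here refl) _   = here refl
    ∈-─⁺ (there w∈)  (there z∈)  z≢w = there (∈-─⁺ w∈ z∈ z≢w)

    AllPairs-─ : ∀ {R : A → A → Set} {xs w} (w∈ : w ∈ xs) → AllPairs R xs → AllPairs R (xs ─ w∈)
    AllPairs-─ (here refl) (_ ∷ rxs)  = rxs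
    AllPairs-─ (there w∈)  (rx ∷ rxs) = ─⁺ w∈ rx ∷ AllPairs-─ w∈ rxs

    AllPairs-─-separated : ∀ {R : A → A → Set} → Symmetric R → ∀ {xs w} (w∈ : w ∈ xs) →
                           AllPairs R xs → All (R w) (xs ─ w∈)
    AllPairs-─-separated sym (here refl) (rw ∷ _)   = rw
    AllPairs-─-separated sym (there w∈)  (rx ∷ rxs) =
      sym (All.lookup rx w∈) ∷ AllPairs-─-separated sym w∈ rxs

  product-─ : ∀ {xs w} (w∈ : w ∈ xs) → product xs ≡ w * product (xs ─ w∈)
  product-─ (here refl) = refl
  product-─ {x ∷ xs} {w} (there w∈) =
    trans (cong (x *_) (product-─ w∈)) (x∙yz≈y∙xz x w (product (xs ─ w∈)))

module Pairing (p : ℕ) (p-prime : Prime p) where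

  open import Data.Nat as ℕ using (suc; _≤_; s≤s; _*_)
  open import Data.Nat.Properties using (≤-refl; ≤-trans; ≤-reflexive; n≤1+n; *-suc)
  open import Data.Nat.ListAction using (product)
  open import Data.Integer using (_^_) renaming (_*_ to _*ℤ_)
  open import Data.Integer.Properties using (pos-*; *-assoc; *-comm; *-zeroʳ)
  open import Data.List using (List; []; _∷_; length)
  open import Data.List.Properties using (length-removeAt′)
  open import Data.List.Membership.Propositional using (_∈_)
  open import Data.List.Relation.Unary.Any using (here; there; index; _─_)
  open import Data.List.Relation.Unary.All as All using (_∷_)
  open import Data.List.Relation.Unary.AllPairs as AllPairs using (AllPairs; _∷_)
  open import Data.Product using (_,_; proj₁; proj₂)
  open import Data.Empty using (⊥-elim)
  open import Function using (_∘_)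
  open import Relation.Binary.PropositionalEquality using (refl; sym; trans; cong; _≢_; module ≡-Reasoning)

  open PrimeModulus p p-prime
  open ListRemoval

  Incongruent : List ℕ → Set
  Incongruent = AllPairs (λ a b → + a ≉ + b)

  record PairedBy (c : ℤ) (xs : List ℕ) : Set where
    field
      incongruent    : Incongruent xs
      partner        : ∀ {z} → z ∈ xs → ∃ λ w → w ∈ xs × + z *ℤ + w ≈ c
      no-self-partner : ∀ {z} → z ∈ xs → + z *ℤ + z ≉ c

  open PairedBy

  ≉-sym : ∀ {a b} → + a ≉ + b → + b ≉ + a
  ≉-sym a≉b b≈a = a≉b (≈-sym b≈a)

  ≉0-of-partner : ∀ {c x y} → x *ℤ y ≈ c → y *ℤ y ≉ c → y ≉ 0ℤ
  ≉0-of-partner {c} {x} {y} xy≈c yy≉c y≈0 = yy≉c (begin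
    y *ℤ y   ≈⟨ *-cong (≈-refl {y}) y≈0 ⟩
    y *ℤ 0ℤ  ≡⟨ *-zeroʳ y ⟩
    0ℤ       ≡⟨ *-zeroʳ x ⟨
    x *ℤ 0ℤ  ≈⟨ *-cong (≈-refl {x}) y≈0 ⟨
    x *ℤ y   ≈⟨ xy≈c ⟩
    c        ∎)
    where open ≈-Reasoning

  PairedBy-─ : ∀ {c x xs w} → PairedBy c (x ∷ xs) → (w∈ : w ∈ xs) → + x *ℤ + w ≈ c →
               PairedBy c (xs ─ w∈)
  -- Partners are unique (cancel the common partner, which is ≉ 0), so the partner of an element
  -- of xs ─ w∈ is neither x nor w.
  PairedBy-─ {c} {x} {xs} {w} P w∈ xw≈c = record
    { incongruent     = AllPairs-─ w∈ xs-incongruent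
    ; partner         = partner′
    ; no-self-partner = λ z∈ → no-self-partner P (there (∈-─⁻ w∈ z∈))
    }
    where
    x≉xs = AllPairs.head (incongruent P)
    xs-incongruent = AllPairs.tail (incongruent P)
    cancel : ∀ {a b d} → d ∈ (x ∷ xs) → + a *ℤ + d ≈ c → + b *ℤ + d ≈ c → + a ≈ + b
    cancel {a} d∈ ad≈c bd≈c =
      *-cancelʳ-≈ _ (≉0-of-partner {x = + a} ad≈c (no-self-partner P d∈)) (≈-trans ad≈c (≈-sym bd≈c))
    partner′ : ∀ {z} → z ∈ (xs ─ w∈) → ∃ λ w′ → w′ ∈ (xs ─ w∈) × + z *ℤ + w′ ≈ c
    partner′ {z} z∈ with partner P (there (∈-─⁻ w∈ z∈))
    ... | _ , here refl , zx≈c =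
      ⊥-elim (All.lookup (AllPairs-─-separated ≉-sym w∈ xs-incongruent) z∈
        (cancel (here refl) (≈-trans (≈-reflexive (*-comm (+ w) (+ x))) xw≈c) zx≈c))
    ... | w′ , there w′∈ , zw′≈c = w′ , ∈-─⁺ w∈ w′∈ w′≢w , zw′≈c
      where
      w′≢w : w′ ≢ w
      w′≢w refl = All.lookup x≉xs (∈-─⁻ w∈ z∈)
        (cancel (there w∈) xw≈c zw′≈c)

  private
    pairing-bounded : ∀ {c} n xs → length xs ≤ n → PairedBy c xs →
                      ∃ λ k → 2 * k ≡ length xs × + product xs ≈ c ^ k
    pairing-bounded _ [] _ _ = 0 , refl , ≈-refl
    pairing-bounded {c} (suc n) (x ∷ xs) (s≤s length≤n) P with partner P (here refl)
    ... | _ , here refl , xx≈c = ⊥-elim (no-self-partner P (here refl) xx≈c)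
    ... | w , there w∈ , xw≈c = suc k , 2[1+k]≡ , product-x∷xs≈
      where
      rest = xs ─ w∈
      length-xs : length xs ≡ suc (length rest)
      length-xs = length-removeAt′ xs (index w∈)
      rest-pairing =
        pairing-bounded n rest (≤-trans (n≤1+n _) (≤-trans (≤-reflexive (sym length-xs)) length≤n))
                        (PairedBy-─ P w∈ xw≈c)
      k = proj₁ rest-pairing
      2k≡ : 2 * k ≡ length rest
      2k≡ = proj₁ (proj₂ rest-pairing)
      2[1+k]≡ : 2 * suc k ≡ suc (length xs)
      2[1+k]≡ = begin
        2 * suc k                 ≡⟨ *-suc 2 k ⟩
        suc (suc (2 * k))         ≡⟨ cong (suc ∘ suc) 2k≡ ⟩
        suc (suc (length rest))   ≡⟨ cong suc length-xs ⟨
        suc (length xs)           ∎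
        where open ≡-Reasoning
      product-x∷xs≈ : + product (x ∷ xs) ≈ c ^ suc k
      product-x∷xs≈ = begin
        + (x * product xs)                 ≡⟨ cong (λ t → + (x * t)) (product-─ w∈) ⟩
        + (x * (w * product rest))         ≡⟨ trans (pos-* x _) (cong (+ x *ℤ_) (pos-* w _)) ⟩
        + x *ℤ (+ w *ℤ + product rest)     ≡⟨ *-assoc (+ x) (+ w) _ ⟨
        (+ x *ℤ + w) *ℤ + product rest     ≈⟨ *-cong xw≈c (proj₂ (proj₂ rest-pairing)) ⟩
        c *ℤ c ^ k                         ∎
        where open ≈-Reasoning

  pairing : ∀ {c} xs → PairedBy c xs → ∃ λ k → 2 * k ≡ length xs × + product xs ≈ c ^ k
  pairing xs = pairing-bounded (length xs) xs ≤-refl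

module Range where

  open import Data.Nat using (zero; suc; _+_; _*_; _≤_; _<_; _∸_; _!)
  open import Data.Nat.Properties using (m≤m+n; +-monoʳ-<; ∸-monoˡ-<; m+n∸m≡n; m+[n∸m]≡n)
  open import Data.Nat.ListAction using (product)
  open import Data.List using (List; applyDownFrom)
  open import Data.List.Membership.Propositional using (_∈_)
  open import Data.List.Membership.Propositional.Properties using (∈-applyDownFrom⁺; ∈-applyDownFrom⁻)
  open import Data.Product using (_,_)
  open import Relation.Binary.PropositionalEquality using (refl; cong; subst)

  range : ℕ → ℕ → List ℕ
  range k n = applyDownFrom (λ i → k + i) n

  ∈-range⁺ : ∀ {k n z} → k ≤ z → z < k + n → z ∈ range k n
  ∈-range⁺ {k} {n} {z} k≤z z<k+n =
    subst (_∈ range k n) (m+[n∸m]≡n k≤z)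
      (∈-applyDownFrom⁺ (λ i → k + i) (subst (z ∸ k <_) (m+n∸m≡n k n) (∸-monoˡ-< z<k+n k≤z)))

  ∈-range⁻ : ∀ {k n z} → z ∈ range k n → k ≤ z × z < k + n
  ∈-range⁻ {k} z∈ with ∈-applyDownFrom⁻ (λ i → k + i) z∈
  ... | i , i<n , refl = m≤m+n k i , +-monoʳ-< k i<n

  product-range-1 : ∀ n → product (range 1 n) ≡ n !
  product-range-1 zero    = refl
  product-range-1 (suc n) = cong (suc n *_) (product-range-1 n)

  product-range-2 : ∀ n → product (range 2 n) ≡ suc n !
  product-range-2 zero    = refl
  product-range-2 (suc n) = cong (suc (suc n) *_) (product-range-2 n)

module FactorialModPrime (p : ℕ) (p-prime : Prime p) where

  open import Data.Nat as ℕ using (zero; suc; _+_; _*_; _≤_; _<_; _∸_; _!; z≤n; s≤s)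
  open import Data.Nat.Properties as ℕ
    using (≤-refl; <⇒≢; m≤n⇒m<n∨m≡n; *-cancelˡ-≡; m+[n∸m]≡n; n≤1+n)
  open import Data.Nat.ListAction using (product)
  open import Data.Integer using (1ℤ; -1ℤ; -_; _^_) renaming (_*_ to _*ℤ_)
  open import Data.Integer.Properties as ℤ using (pos-*; +-comm; ^-zeroˡ; *-zeroʳ; *-identityʳ)
  open import Data.Integer.Divisibility.Signed using (divides; ∣-refl)
  open import Data.Integer.Tactic.RingSolver using (solve-∀)
  open import Data.List.Membership.Propositional using (_∈_)
  open import Data.List.Properties using (length-applyDownFrom)
  open import Data.List.Relation.Unary.AllPairs.Properties using (applyDownFrom⁺₁)
  open import Data.Product using (_,_; proj₁; proj₂)
  open import Data.Sum using (inj₁; inj₂)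
  open import Data.Empty using (⊥-elim)
  open import Relation.Binary.PropositionalEquality using (refl; sym; trans; cong; subst; _≢_)
  open import Algebra.Properties.CommutativeSemigroup ℤ.*-commutativeSemigroup using (x∙yz≈y∙xz)

  open PrimeModulus p p-prime
  open Pairing p p-prime
  open Range

  range-incongruent : ∀ k n → k + n ≤ p → Incongruent (range k n)
  range-incongruent k n k+n≤p = applyDownFrom⁺₁ _ n λ {i} {j} j<i i<n k+i≈k+j →
    <⇒≢ (ℕ.+-monoʳ-< k j<i)
      (sym (residue-unique (below (ℕ.+-monoʳ-< k i<n)) (below (ℕ.+-monoʳ-< k (ℕ.<-trans j<i i<n))) k+i≈k+j))
    where
    below : ∀ {z} → z < k + n → z < p
    below z<k+n = ℕ.<-≤-trans z<k+n k+n≤p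

  p-1≈-1 : ∀ {r} → p ≡ suc r → + r ≈ -1ℤ
  p-1≈-1 {r} refl = -≈0⇒≈ (≈-trans (≈-reflexive (+-comm (+ r) 1ℤ)) (∣⇒≈0 ∣-refl))

  ≈-1⇒≡p-1 : ∀ {z r} → p ≡ suc r → z < p → + z ≈ -1ℤ → z ≡ r
  ≈-1⇒≡p-1 p≡ z<p z≈-1 =
    residue-unique z<p (subst (_ <_) (sym p≡) ≤-refl) (≈-trans z≈-1 (≈-sym (p-1≈-1 p≡)))

  ≈1⇒≡1 : ∀ {z} → z < p → + z ≈ 1ℤ → z ≡ 1
  ≈1⇒≡1 z<p z≈1 = residue-unique z<p 1<p z≈1

  private
    wilson-partner-bounds : ∀ {s z} w → p ≡ 3 + s → 2 ≤ z → z < 2 + s → w < p →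
                            + z *ℤ + w ≈ 1ℤ → 2 ≤ w × w < 2 + s
    wilson-partner-bounds {z = z} zero _ _ _ _ z0≈1 =
      ⊥-elim (1≉0 (≈-trans (≈-sym z0≈1) (≈-reflexive (*-zeroʳ (+ z)))))
    wilson-partner-bounds {z = z} (suc zero) refl 2≤z z<top _ z1≈1 =
      ⊥-elim (<⇒≢ 2≤z (sym (≈1⇒≡1 (ℕ.<-trans z<top (ℕ.n<1+n _))
                                   (≈-trans (≈-reflexive (sym (*-identityʳ (+ z)))) z1≈1))))
    wilson-partner-bounds {s} {z} (suc (suc w)) refl _ z<top (s≤s w<1+top) zw≈1
      with m≤n⇒m<n∨m≡n w<1+top
    ... | inj₁ w<top = s≤s (s≤s z≤n) , w<top
    ... | inj₂ refl  = ⊥-elim (<⇒≢ z<top (≈-1⇒≡p-1 refl (ℕ.<-trans z<top (ℕ.n<1+n _)) z≈-1))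
      where
      open ≈-Reasoning
      z≈-1 : + z ≈ -1ℤ
      z≈-1 = begin
        + z                        ≡⟨ negate-twice (+ z) ⟩
        - (+ z *ℤ -1ℤ)             ≈⟨ -‿cong (*-cong (≈-refl {+ z}) (p-1≈-1 refl)) ⟨
        - (+ z *ℤ + (2 + s))       ≈⟨ -‿cong zw≈1 ⟩
        -1ℤ                        ∎
        where
        negate-twice : ∀ x → x ≡ - (x *ℤ -1ℤ)
        negate-twice = solve-∀

  inverse-pairing : ∀ s → p ≡ 3 + s → PairedBy 1ℤ (range 2 s)
  inverse-pairing s refl = record
    { incongruent     = range-incongruent 2 s (n≤1+n _)
    ; partner         = partner
    ; no-self-partner = no-self-partner
    }
    where
    below-p : ∀ {z} → z ∈ range 2 s → z < p
    below-p z∈ = ℕ.<-trans (proj₂ (∈-range⁻ z∈)) (ℕ.n<1+n _)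
    partner : ∀ {z} → z ∈ range 2 s → ∃ λ w → w ∈ range 2 s × + z *ℤ + w ≈ 1ℤ
    partner {z} z∈
      with inverse (+ z) (positive-residue≉0 (ℕ.<-trans (s≤s z≤n) (proj₁ (∈-range⁻ z∈))) (below-p z∈))
    ... | t , zt≈1 = w , ∈-range⁺ (proj₁ bounds) (proj₂ bounds) , zw≈1
      where
      w = residue t
      zw≈1 : + z *ℤ + w ≈ 1ℤ
      zw≈1 = ≈-trans (*-cong (≈-refl {+ z}) (≈-sym (≈-residue t))) zt≈1
      bounds = wilson-partner-bounds w refl (proj₁ (∈-range⁻ z∈)) (proj₂ (∈-range⁻ z∈))
                                     (residue<p t) zw≈1
    no-self-partner : ∀ {z} → z ∈ range 2 s → + z *ℤ + z ≉ 1ℤ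
    no-self-partner {z} z∈ z²≈1 with square≈1⇒≈±1 (+ z) z²≈1
    ... | inj₁ z≈1  = <⇒≢ (proj₁ (∈-range⁻ z∈)) (sym (≈1⇒≡1 (below-p z∈) z≈1))
    ... | inj₂ z≈-1 = <⇒≢ (proj₂ (∈-range⁻ z∈)) (≈-1⇒≡p-1 refl (below-p z∈) z≈-1)

  wilson : + ((p ∸ 1) !) ≈ -1ℤ
  wilson = wilson′ (p ∸ 2) (sym (m+[n∸m]≡n 1<p))
    where
    wilson′ : ∀ r → p ≡ 2 + r → + ((p ∸ 1) !) ≈ -1ℤ
    wilson′ zero    refl = mk (divides 1ℤ refl)
    wilson′ (suc s) refl = begin
      + ((2 + s) !)                 ≡⟨ cong (λ t → + ((2 + s) * t)) (product-range-2 s) ⟨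
      + ((2 + s) * product L)       ≡⟨ pos-* (2 + s) (product L) ⟩
      + (2 + s) *ℤ + product L      ≈⟨ *-cong (p-1≈-1 refl) (proj₂ (proj₂ L-pairing)) ⟩
      -1ℤ *ℤ 1ℤ ^ proj₁ L-pairing   ≡⟨ cong (-1ℤ *ℤ_) (^-zeroˡ (proj₁ L-pairing)) ⟩
      -1ℤ                           ∎
      where
      open ≈-Reasoning
      L = range 2 s
      L-pairing = pairing L (inverse-pairing s refl)

  nonresidue-pairing : ∀ {c} h → p ≡ suc (2 * h) → (∀ z → z < p → + z *ℤ + z ≉ c) →
                       PairedBy c (range 1 (2 * h))
  nonresidue-pairing {c} h refl nonresidue = record
    { incongruent     = range-incongruent 1 (2 * h) ≤-refl
    ; partner         = partner
    ; no-self-partner = λ {z} z∈ → nonresidue z (below-p z∈)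
    }
    where
    open ≈-Reasoning
    below-p : ∀ {z} → z ∈ range 1 (2 * h) → z < p
    below-p z∈ = proj₂ (∈-range⁻ z∈)
    c≉0 : c ≉ 0ℤ
    c≉0 c≈0 = nonresidue 0 (s≤s z≤n) (≈-sym c≈0)
    partner : ∀ {z} → z ∈ range 1 (2 * h) → ∃ λ w → w ∈ range 1 (2 * h) × + z *ℤ + w ≈ c
    partner {z} z∈ with inverse (+ z) (positive-residue≉0 (proj₁ (∈-range⁻ z∈)) (below-p z∈))
    ... | t , zt≈1 = w , ∈-range⁺ (ℕ.n≢0⇒n>0 w≢0) (residue<p (c *ℤ t)) , zw≈c
      where
      w = residue (c *ℤ t)
      zw≈c : + z *ℤ + w ≈ c
      zw≈c = begin
        + z *ℤ + w          ≈⟨ *-cong (≈-refl {+ z}) (≈-residue (c *ℤ t)) ⟨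
        + z *ℤ (c *ℤ t)     ≡⟨ x∙yz≈y∙xz (+ z) c t ⟩
        c *ℤ (+ z *ℤ t)     ≈⟨ *-cong (≈-refl {c}) zt≈1 ⟩
        c *ℤ 1ℤ             ≡⟨ *-identityʳ c ⟩
        c                   ∎
      w≢0 : w ≢ 0
      w≢0 w≡0 = c≉0 (begin
        c                   ≈⟨ zw≈c ⟨
        + z *ℤ + w          ≡⟨ cong (λ n → + z *ℤ + n) w≡0 ⟩
        + z *ℤ 0ℤ           ≡⟨ *-zeroʳ (+ z) ⟩
        0ℤ                  ∎)

  nonresidue⇒factorial≈power : ∀ {c} h → p ≡ suc (2 * h) →
                               (∀ z → z < p → + z *ℤ + z ≉ c) → + ((2 * h) !) ≈ c ^ h
  nonresidue⇒factorial≈power {c} h p≡ nonresidue = begin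
    + ((2 * h) !)     ≡⟨ cong +_ (product-range-1 (2 * h)) ⟨
    + product L       ≈⟨ proj₂ (proj₂ L-pairing) ⟩
    c ^ k             ≡⟨ cong (c ^_) k≡h ⟩
    c ^ h             ∎
    where
    open ≈-Reasoning
    L = range 1 (2 * h)
    L-pairing = pairing L (nonresidue-pairing h p≡ nonresidue)
    k = proj₁ L-pairing
    k≡h : k ≡ h
    k≡h = *-cancelˡ-≡ k h 2 (trans (proj₁ (proj₂ L-pairing)) (length-applyDownFrom _ (2 * h)))

module EvenOddProducts where

  open import Data.Nat as ℕ using (zero; suc; _!)
  open import Data.Nat.Properties as ℕ using (+-suc)
  open import Data.Integer using (1ℤ; -1ℤ; _+_; _-_; _*_; _^_)
  open import Data.Integer.Properties using (pos-*; pos-+; *-identityʳ)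
  open import Data.Integer.Tactic.RingSolver using (solve-∀)
  open import Data.Product using (_,_; proj₁; proj₂)
  open import Data.Sum using (_⊎_; inj₁; inj₂)
  open import Relation.Binary.PropositionalEquality using (refl; sym; trans; cong; cong₂; module ≡-Reasoning)
  open ≡-Reasoning

  evenProduct : ℕ → ℤ
  evenProduct zero    = 1ℤ
  evenProduct (suc n) = evenProduct n * (+ 2 * + suc n)

  oddProduct : ℕ → ℤ
  oddProduct zero    = 1ℤ
  oddProduct (suc n) = oddProduct n * (+ 2 * + n + 1ℤ)

  upperEvenProduct : ℤ → ℕ → ℤ
  upperEvenProduct t zero    = 1ℤ
  upperEvenProduct t (suc r) = upperEvenProduct t r * (+ 2 * (t - + r))

  pos-suc : ∀ n → + suc n ≡ + n + 1ℤ
  pos-suc n = trans (cong +_ (ℕ.+-comm 1 n)) (pos-+ n 1)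

  evenProduct≡2^n*n! : ∀ n → evenProduct n ≡ (+ 2) ^ n * + (n !)
  evenProduct≡2^n*n! zero    = refl
  evenProduct≡2^n*n! (suc n) = begin
    evenProduct n * (+ 2 * + suc n)          ≡⟨ cong (_* (+ 2 * + suc n)) (evenProduct≡2^n*n! n) ⟩
    (+ 2) ^ n * + (n !) * (+ 2 * + suc n)      ≡⟨ reassociate ((+ 2) ^ n) (+ (n !)) (+ suc n) ⟩
    + 2 * (+ 2) ^ n * (+ suc n * + (n !))      ≡⟨ cong (+ 2 * (+ 2) ^ n *_) (pos-* (suc n) (n !)) ⟨
    + 2 * (+ 2) ^ n * + (suc n !)              ∎
    where
    reassociate : ∀ a f s → a * f * (+ 2 * s) ≡ + 2 * a * (s * f)
    reassociate = solve-∀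

  pos-double : ∀ n → + (n ℕ.+ n) ≡ + 2 * + n
  pos-double n = trans (pos-+ n n) (double (+ n))
    where
    double : ∀ x → x + x ≡ + 2 * x
    double = solve-∀

  factorial-interleave : ∀ m → + ((m ℕ.+ m) !) ≡ evenProduct m * oddProduct m
                             × + (suc (m ℕ.+ m) !) ≡ evenProduct m * oddProduct (suc m)
  factorial-interleave zero    = refl , refl
  factorial-interleave (suc m) = even-case , odd-case
    where
    E = evenProduct
    O = oddProduct
    2m+2 = suc m ℕ.+ suc m
    even-case : + (2m+2 !) ≡ E (suc m) * O (suc m)
    even-case = begin
      + (2m+2 !)                                 ≡⟨ cong (λ n → + (suc n !)) (+-suc m m) ⟩
      + (suc (suc (m ℕ.+ m)) ℕ.* suc (m ℕ.+ m) !) ≡⟨ pos-* (suc (suc (m ℕ.+ m))) (suc (m ℕ.+ m) !) ⟩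
      + suc (suc (m ℕ.+ m)) * + (suc (m ℕ.+ m) !)
        ≡⟨ cong₂ _*_ 2m+2≡ (proj₂ (factorial-interleave m)) ⟩
      (+ 2 * + suc m) * (E m * O (suc m))          ≡⟨ reassociate (+ 2 * + suc m) (E m) (O (suc m)) ⟩
      E m * (+ 2 * + suc m) * O (suc m)            ∎
      where
      2m+2≡ : + suc (suc (m ℕ.+ m)) ≡ + 2 * + suc m
      2m+2≡ = trans (cong +_ (sym (cong suc (+-suc m m)))) (pos-double (suc m))
      reassociate : ∀ a e o → a * (e * o) ≡ e * a * o
      reassociate = solve-∀
    odd-case : + (suc 2m+2 !) ≡ E (suc m) * O (suc (suc m))
    odd-case = begin
      + (suc 2m+2 ℕ.* 2m+2 !)                     ≡⟨ pos-* (suc 2m+2) (2m+2 !) ⟩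
      + suc 2m+2 * + (2m+2 !)                     ≡⟨ cong₂ _*_ 2m+3≡ even-case ⟩
      (+ 2 * + suc m + 1ℤ) * (E (suc m) * O (suc m))
        ≡⟨ reassociate (+ 2 * + suc m + 1ℤ) (E (suc m)) (O (suc m)) ⟩
      E (suc m) * (O (suc m) * (+ 2 * + suc m + 1ℤ)) ∎
      where
      2m+3≡ : + suc 2m+2 ≡ + 2 * + suc m + 1ℤ
      2m+3≡ = trans (pos-suc 2m+2) (cong (_+ 1ℤ) (pos-double (suc m)))
      reassociate : ∀ a e o → a * (e * o) ≡ e * (o * a)
      reassociate = solve-∀

  upperEvenProduct-shift : ∀ t r → upperEvenProduct (t + 1ℤ) (suc r) ≡ + 2 * (t + 1ℤ) * upperEvenProduct t r
  upperEvenProduct-shift t zero    = base t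
    where
    base : ∀ t → 1ℤ * (+ 2 * ((t + 1ℤ) - + 0)) ≡ + 2 * (t + 1ℤ) * 1ℤ
    base = solve-∀
  upperEvenProduct-shift t (suc r) = begin
    upperEvenProduct (t + 1ℤ) (suc r) * (+ 2 * ((t + 1ℤ) - + suc r))
      ≡⟨ cong₂ (λ u s → u * (+ 2 * ((t + 1ℤ) - s))) (upperEvenProduct-shift t r) (pos-suc r) ⟩
    + 2 * (t + 1ℤ) * upperEvenProduct t r * (+ 2 * ((t + 1ℤ) - (+ r + 1ℤ)))
      ≡⟨ reassociate t (upperEvenProduct t r) (+ r) ⟩
    + 2 * (t + 1ℤ) * (upperEvenProduct t r * (+ 2 * (t - + r)))
      ∎
    where
    reassociate : ∀ t u r → + 2 * (t + 1ℤ) * u * (+ 2 * ((t + 1ℤ) - (r + 1ℤ)))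
                           ≡ + 2 * (t + 1ℤ) * (u * (+ 2 * (t - r)))
    reassociate = solve-∀

  evenProduct-split : ∀ m r → evenProduct (m ℕ.+ r) ≡ evenProduct m * upperEvenProduct (+ (m ℕ.+ r)) r
  evenProduct-split m zero    = trans (cong evenProduct (ℕ.+-identityʳ m)) (sym (*-identityʳ (evenProduct m)))
  evenProduct-split m (suc r) = begin
    evenProduct (m ℕ.+ suc r)                      ≡⟨ cong evenProduct (+-suc m r) ⟩
    evenProduct (m ℕ.+ r) * (+ 2 * + suc (m ℕ.+ r))
      ≡⟨ cong₂ _*_ (evenProduct-split m r) (cong (+ 2 *_) (pos-suc (m ℕ.+ r))) ⟩
    evenProduct m * U t r * (+ 2 * (t + 1ℤ))        ≡⟨ reassociate (evenProduct m) (U t r) t ⟩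
    evenProduct m * (+ 2 * (t + 1ℤ) * U t r)        ≡⟨ cong (evenProduct m *_) (upperEvenProduct-shift t r) ⟨
    evenProduct m * U (t + 1ℤ) (suc r)              ≡⟨ cong (λ s → evenProduct m * U s (suc r)) t+1≡ ⟩
    evenProduct m * U (+ (m ℕ.+ suc r)) (suc r)     ∎
    where
    U = upperEvenProduct
    t = + (m ℕ.+ r)
    t+1≡ : t + 1ℤ ≡ + (m ℕ.+ suc r)
    t+1≡ = trans (sym (pos-suc (m ℕ.+ r))) (cong +_ (sym (+-suc m r)))
    reassociate : ∀ e u t → e * u * (+ 2 * (t + 1ℤ)) ≡ e * (+ 2 * (t + 1ℤ) * u)
    reassociate = solve-∀

  factorial≡evenProduct*oddProduct : ∀ m r → r ≡ m ⊎ r ≡ suc m →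
                                     + ((m ℕ.+ r) !) ≡ evenProduct m * oddProduct r
  factorial≡evenProduct*oddProduct m _ (inj₁ refl) = proj₁ (factorial-interleave m)
  factorial≡evenProduct*oddProduct m _ (inj₂ refl) =
    trans (cong (λ n → + (n !)) (+-suc m m)) (proj₂ (factorial-interleave m))

  -1^[e+e]≡1 : ∀ e → -1ℤ ^ (e ℕ.+ e) ≡ 1ℤ
  -1^[e+e]≡1 zero    = refl
  -1^[e+e]≡1 (suc e) = begin
    -1ℤ ^ suc (e ℕ.+ suc e)        ≡⟨ cong (λ n → -1ℤ ^ suc n) (+-suc e e) ⟩
    -1ℤ * (-1ℤ * -1ℤ ^ (e ℕ.+ e))  ≡⟨ cong (λ x → -1ℤ * (-1ℤ * x)) (-1^[e+e]≡1 e) ⟩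
    1ℤ                             ∎

module NatArithmetic where

  open import Data.Nat using (suc; _+_; _*_; _^_; _<_; _≤_; z≤n; s≤s; NonZero; ≢-nonZero)
  open import Data.Nat.Properties using (+-identityʳ; *-assoc; *-comm; m<m*n)
  open import Data.Nat.DivMod using (m%n<n; m∣n⇒o%n%m≡o%m; m%n*o≡m*o%[n*o])
  open import Data.Nat.Divisibility using (_∣_; _∣?_; divides; n∣m⇒m%n≡0; m%n≡0⇒n∣m)
  open import Data.Nat.Induction using (<-rec)
  open import Data.Product using (_,_; ∃₂)
  open import Data.Sum using (_⊎_; inj₁; inj₂)
  open import Data.Empty using (⊥-elim)
  open import Relation.Nullary using (yes; no)
  open import Relation.Binary.PropositionalEquality using (refl; sym; trans; cong; _≢_)

  %-divisor : ∀ d m v {r} .{{_ : NonZero d}} .{{_ : NonZero m}} → d ∣ m → v % m ≡ r → v % d ≡ r % d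
  %-divisor d m v d∣m v%m≡r = trans (sym (m∣n⇒o%n%m≡o%m d m v d∣m)) (cong (_% d) v%m≡r)

  odd-of-residue : ∀ {m v r} .{{_ : NonZero m}} → 2 ∣ m → v % m ≡ r → r % 2 ≡ 1 → ¬ 2 ∣ v
  odd-of-residue 2∣m v%m≡r r%2≡1 2∣v
    with trans (sym (trans (%-divisor 2 _ _ 2∣m v%m≡r) r%2≡1)) (n∣m⇒m%n≡0 _ 2 2∣v)
  ... | ()

  even-of-residue : ∀ {m v r} .{{_ : NonZero m}} → 2 ∣ m → v % m ≡ r → r % 2 ≡ 0 → 2 ∣ v
  even-of-residue 2∣m v%m≡r r%2≡0 = m%n≡0⇒n∣m _ 2 (trans (%-divisor 2 _ _ 2∣m v%m≡r) r%2≡0)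

  odd-residue-mod-8 : ∀ q → ¬ 2 ∣ q → ¬ PlusMinus3Mod8 q → q % 8 ≡ 1 ⊎ q % 8 ≡ 7
  odd-residue-mod-8 q q-odd not±3 with q % 8 in q%8≡ | m%n<n q 8
  ... | 0 | _ = ⊥-elim (q-odd (even-of-residue (divides 4 refl) q%8≡ refl))
  ... | 1 | _ = inj₁ refl
  ... | 2 | _ = ⊥-elim (q-odd (even-of-residue (divides 4 refl) q%8≡ refl))
  ... | 3 | _ = ⊥-elim (not±3 (inj₁ refl))
  ... | 4 | _ = ⊥-elim (q-odd (even-of-residue (divides 4 refl) q%8≡ refl))
  ... | 5 | _ = ⊥-elim (not±3 (inj₂ refl))
  ... | 6 | _ = ⊥-elim (q-odd (even-of-residue (divides 4 refl) q%8≡ refl))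
  ... | 7 | _ = inj₂ refl
  ... | suc (suc (suc (suc (suc (suc (suc (suc _)))))))
      | s≤s (s≤s (s≤s (s≤s (s≤s (s≤s (s≤s (s≤s ())))))))

  mod-36-of-3u : ∀ {v u} → v ≡ 3 * u → u % 3 ≡ 2 → v % 12 ≡ 3 → v % 36 ≡ 15
  mod-36-of-3u {v} {u} refl u%3≡2 v%12≡3 = trans v%36≡r*3 (r*3≡15 (m%n<n u 12) r%3≡2 r*3%12≡3)
    where
    r = u % 12
    v%36≡r*3 : v % 36 ≡ r * 3
    v%36≡r*3 = trans (cong (_% 36) (*-comm 3 u)) (sym (m%n*o≡m*o%[n*o] u 12 3))
    r%3≡2 : r % 3 ≡ 2
    r%3≡2 = trans (sym (%-divisor 3 12 u (divides 4 refl) refl)) u%3≡2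
    r*3%12≡3 : r * 3 % 12 ≡ 3
    r*3%12≡3 = trans (sym (%-divisor 12 36 v (divides 3 refl) v%36≡r*3)) v%12≡3
    r*3≡15 : ∀ {r} → r < 12 → r % 3 ≡ 2 → r * 3 % 12 ≡ 3 → r * 3 ≡ 15
    r*3≡15 {0}  _ () _
    r*3≡15 {1}  _ () _
    r*3≡15 {2}  _ _ ()
    r*3≡15 {3}  _ () _
    r*3≡15 {4}  _ () _
    r*3≡15 {5}  _ _ _ = refl
    r*3≡15 {6}  _ () _
    r*3≡15 {7}  _ () _
    r*3≡15 {8}  _ _ ()
    r*3≡15 {9}  _ () _
    r*3≡15 {10} _ () _
    r*3≡15 {11} _ _ ()
    r*3≡15 {suc (suc (suc (suc (suc (suc (suc (suc (suc (suc (suc (suc _)))))))))))}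
      (s≤s (s≤s (s≤s (s≤s (s≤s (s≤s (s≤s (s≤s (s≤s (s≤s (s≤s (s≤s ())))))))))))) _ _

  factor-out-power : ∀ m {n} → 1 < m → n ≢ 0 → ∃₂ λ k u → n ≡ m ^ k * u × ¬ m ∣ u
  factor-out-power m {n} 1<m = <-rec (λ n → n ≢ 0 → ∃₂ λ k u → n ≡ m ^ k * u × ¬ m ∣ u) step n
    where
    step : ∀ n → (∀ {q} → q < n → q ≢ 0 → ∃₂ λ k u → q ≡ m ^ k * u × ¬ m ∣ u) →
           n ≢ 0 → ∃₂ λ k u → n ≡ m ^ k * u × ¬ m ∣ u
    step n rec n≢0 with m ∣? n
    ... | no m∤n = 0 , n , sym (+-identityʳ n) , m∤n
    ... | yes (divides q refl) with rec q<q*m q≢0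
      where
      q≢0 : q ≢ 0
      q≢0 refl = n≢0 refl
      q<q*m : q < q * m
      q<q*m = m<m*n q m {{≢-nonZero q≢0}} 1<m
    ...   | k , u , refl , m∤u = suc k , u , trans (*-comm (m ^ k * u) m) (sym (*-assoc m (m ^ k) u)) , m∤u

  3<residue-prime : ∀ {q} → Prime q → q % 8 ≡ 1 ⊎ q % 8 ≡ 7 → 3 < q
  3<residue-prime {0}  () _
  3<residue-prime {1}  () _
  3<residue-prime {2}  _ (inj₁ ())
  3<residue-prime {2}  _ (inj₂ ())
  3<residue-prime {3}  _ (inj₁ ())
  3<residue-prime {3}  _ (inj₂ ())
  3<residue-prime {suc (suc (suc (suc _)))} _ _ = s≤s (s≤s (s≤s (s≤s z≤n)))

module TwoIsSquare (p : ℕ) (p-prime : Prime p) where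

  open import Data.Nat as ℕ using (zero; suc; _*_; _<_; _!; _∸_; z≤n; s≤s)
  open import Data.Nat.Properties as ℕ using (+-suc)
  open import Data.Nat.DivMod using (m≡m%n+[m/n]*n)
  import Data.Nat.Tactic.RingSolver as ℕ-Solver
  open import Data.Integer using (1ℤ; -1ℤ; _+_; _-_; _^_) renaming (_*_ to _*ℤ_)
  open import Data.Integer.Properties using (pos-*; *-identityˡ)
  open import Data.Integer.Divisibility.Signed using (∣-refl)
  open import Data.Integer.Tactic.RingSolver using (solve-∀)
  open import Data.Fin using (Fin; toℕ; fromℕ<)
  open import Data.Fin.Properties using (any?; toℕ-fromℕ<)
  open import Data.Product using (_,_; proj₁; proj₂)
  open import Data.Sum using (_⊎_; inj₁; inj₂)
  open import Data.Empty using (⊥-elim)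
  open import Relation.Nullary using (yes; no)
  open import Relation.Binary.PropositionalEquality using (refl; sym; trans; cong; subst)

  open PrimeModulus p p-prime
  open FactorialModPrime p p-prime
  open EvenOddProducts
  open NatArithmetic using (3<residue-prime)

  upperEvenProduct≈ : ∀ {t} → + 2 *ℤ t + 1ℤ ≈ 0ℤ → ∀ r →
                      upperEvenProduct t r ≈ -1ℤ ^ r *ℤ oddProduct r
  upperEvenProduct≈ _       zero    = ≈-refl
  upperEvenProduct≈ {t} 2t+1≈0 (suc r) = begin
    upperEvenProduct t r *ℤ (+ 2 *ℤ (t - + r))
      ≈⟨ *-cong (upperEvenProduct≈ 2t+1≈0 r) (≈-reflexive (split t (+ r))) ⟩
    -1ℤ ^ r *ℤ oddProduct r *ℤ ((+ 2 *ℤ t + 1ℤ) - (+ 2 *ℤ + r + 1ℤ))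
      ≈⟨ *-cong (≈-refl { -1ℤ ^ r *ℤ oddProduct r}) (+-cong 2t+1≈0 ≈-refl) ⟩
    -1ℤ ^ r *ℤ oddProduct r *ℤ (0ℤ - (+ 2 *ℤ + r + 1ℤ))
      ≡⟨ reassociate (-1ℤ ^ r) (oddProduct r) (+ 2 *ℤ + r + 1ℤ) ⟩
    -1ℤ *ℤ -1ℤ ^ r *ℤ (oddProduct r *ℤ (+ 2 *ℤ + r + 1ℤ))
      ∎
    where
    open ≈-Reasoning
    split : ∀ t r → + 2 *ℤ (t - r) ≡ (+ 2 *ℤ t + 1ℤ) - (+ 2 *ℤ r + 1ℤ)
    split = solve-∀
    reassociate : ∀ s o q → s *ℤ o *ℤ (0ℤ - q) ≡ -1ℤ *ℤ s *ℤ (o *ℤ q)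
    reassociate = solve-∀

  factorial≉0 : ∀ n → n < p → + (n !) ≉ 0ℤ
  factorial≉0 zero    _   = 1≉0
  factorial≉0 (suc n) n<p n!≈0
    with *≈0⇒≈0⊎≈0 (+ suc n) (+ (n !)) (≈-trans (≈-reflexive (sym (pos-* (suc n) (n !)))) n!≈0)
  ... | inj₁ 1+n≈0 = positive-residue≉0 (s≤s z≤n) n<p 1+n≈0
  ... | inj₂ n!≈0  = factorial≉0 n (ℕ.<-trans (ℕ.n<1+n n) n<p) n!≈0

  -- Gauss's lemma for 2: modulo p = 2h + 1 the even numbers 2(m + 1), …, 2h are −(2r − 1), …, −1,
  -- so 2^h·h! ≡ (−1)^r·h!, where m and r count the even numbers 2k ≤ h and 2k > h.
  2^[m+r]≈1 : ∀ m r e → r ≡ e ℕ.+ e → r ≡ m ⊎ r ≡ suc m → p ≡ suc (2 * (m ℕ.+ r)) →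
              (+ 2) ^ (m ℕ.+ r) ≈ 1ℤ
  2^[m+r]≈1 m r e r≡e+e r≡m∨1+m p≡ = *-cancelʳ-≈ (+ (h !)) (factorial≉0 h h<p) (begin
    (+ 2) ^ h *ℤ + (h !)                  ≡⟨ evenProduct≡2^n*n! h ⟨
    evenProduct h                         ≡⟨ evenProduct-split m r ⟩
    evenProduct m *ℤ upperEvenProduct (+ h) r
      ≈⟨ *-cong (≈-refl {evenProduct m}) (upperEvenProduct≈ 2h+1≈0 r) ⟩
    evenProduct m *ℤ (-1ℤ ^ r *ℤ oddProduct r)
      ≡⟨ cong (λ s → evenProduct m *ℤ (s *ℤ oddProduct r))
              (trans (cong (-1ℤ ^_) r≡e+e) (-1^[e+e]≡1 e)) ⟩
    evenProduct m *ℤ (1ℤ *ℤ oddProduct r) ≡⟨ cong (evenProduct m *ℤ_) (*-identityˡ (oddProduct r)) ⟩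
    evenProduct m *ℤ oddProduct r         ≡⟨ factorial≡evenProduct*oddProduct m r r≡m∨1+m ⟨
    + (h !)                               ≡⟨ *-identityˡ (+ (h !)) ⟨
    1ℤ *ℤ + (h !)                         ∎)
    where
    open ≈-Reasoning
    h = m ℕ.+ r
    h<p : h < p
    h<p = subst (h <_) (sym p≡) (s≤s (ℕ.m≤n*m h 2))
    2h+1≈0 : + 2 *ℤ + h + 1ℤ ≈ 0ℤ
    2h+1≈0 = ≈-trans (≈-reflexive (trans (cong (_+ 1ℤ) (sym (pos-* 2 h))) (sym (pos-suc (2 * h)))))
                     (subst (λ n → + n ≈ 0ℤ) p≡ (∣⇒≈0 ∣-refl))

  2^h≈1 : p % 8 ≡ 1 ⊎ p % 8 ≡ 7 → ∃ λ h → p ≡ suc (2 * h) × (+ 2) ^ h ≈ 1ℤ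
  2^h≈1 (inj₁ p%8≡1) = m ℕ.+ m , p≡ , 2^[m+r]≈1 m m k refl (inj₁ refl) p≡
    where
    k = p / 8
    m = k ℕ.+ k
    p≡ : p ≡ suc (2 * (m ℕ.+ m))
    p≡ = trans (m≡m%n+[m/n]*n p 8) (trans (cong (ℕ._+ k * 8) p%8≡1) (lemma k))
      where
      lemma : ∀ k → 1 ℕ.+ k * 8 ≡ suc (2 * ((k ℕ.+ k) ℕ.+ (k ℕ.+ k)))
      lemma = ℕ-Solver.solve-∀
  2^h≈1 (inj₂ p%8≡7) = m ℕ.+ suc m , p≡ , 2^[m+r]≈1 m (suc m) (suc k) r≡ (inj₂ refl) p≡
    where
    k = p / 8
    m = suc (k ℕ.+ k)
    r≡ : suc m ≡ suc k ℕ.+ suc k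
    r≡ = cong suc (sym (+-suc k k))
    p≡ : p ≡ suc (2 * (m ℕ.+ suc m))
    p≡ = trans (m≡m%n+[m/n]*n p 8) (trans (cong (ℕ._+ k * 8) p%8≡7) (lemma k))
      where
      lemma : ∀ k → 7 ℕ.+ k * 8 ≡ suc (2 * (suc (k ℕ.+ k) ℕ.+ suc (suc (k ℕ.+ k))))
      lemma = ℕ-Solver.solve-∀

  two-is-square : p % 8 ≡ 1 ⊎ p % 8 ≡ 7 → ∃ λ y → + y *ℤ + y ≈ + 2
  two-is-square p%8 with any? (λ (i : Fin p) → + toℕ i *ℤ + toℕ i ≈? + 2)
  ... | yes (i , i²≈2) = toℕ i , i²≈2
  ... | no no-root     =
    ⊥-elim (positive-residue≉0 (s≤s z≤n) (ℕ.<⇒≤ (3<residue-prime p-prime p%8)) 2≈0)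
    where
    open ≈-Reasoning
    h = proj₁ (2^h≈1 p%8)
    p≡ = proj₁ (proj₂ (2^h≈1 p%8))
    nonresidue : ∀ z → z < p → + z *ℤ + z ≉ + 2
    nonresidue z z<p z²≈2 =
      no-root (fromℕ< z<p , subst (λ n → + n *ℤ + n ≈ + 2) (sym (toℕ-fromℕ< z<p)) z²≈2)
    -1≈1 : -1ℤ ≈ 1ℤ
    -1≈1 = begin
      -1ℤ              ≈⟨ wilson ⟨
      + ((p ∸ 1) !)    ≡⟨ cong (λ n → + ((n ∸ 1) !)) p≡ ⟩
      + ((2 * h) !)    ≈⟨ nonresidue⇒factorial≈power h p≡ nonresidue ⟩
      (+ 2) ^ h        ≈⟨ proj₂ (proj₂ (2^h≈1 p%8)) ⟩
      1ℤ               ∎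
    2≈0 : + 2 ≈ 0ℤ
    2≈0 = ≈⇒-≈0 (≈-sym -1≈1)

module Factorisation where

  open import Data.Nat using (_*_; _<_; NonZero)
  open import Data.Nat.Properties using (_≟_)
  open import Data.Nat.Divisibility using (_∣_; ∣-trans; m∣m*n; ∣n⇒∣m*n; *-monoʳ-∣)
  open import Data.Nat.Primality.Factorisation using (factorise; PrimeFactorisation)
  open import Data.Nat.ListAction using (product)
  open import Data.Nat.ListAction.Properties using (∈⇒∣product)
  open import Data.List using ([]; _∷_)
  open import Data.List.Membership.DecPropositional _≟_ using (_∈?_)
  open import Data.List.Relation.Unary.All using (All; []; _∷_)
  open import Data.List.Relation.Unary.All.Properties using (¬Any⇒All¬)
  open import Data.List.Relation.Unary.AllPairs using ([]; _∷_)
  open import Data.Product using (_,_)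
  open import Data.Sum as Sum using (_⊎_; inj₁; inj₂)
  open import Function using (_∘_)
  open import Relation.Nullary using (yes; no)
  open import Relation.Nullary.Decidable using (_⊎-dec_)
  open import Relation.Binary.PropositionalEquality using (subst; sym)
  open NatArithmetic using (odd-residue-mod-8)

  data SquareOrResidueDivisor (n : ℕ) : Set where
    square-divisor  : ∀ {q} → 1 < q → q * q ∣ n → SquareOrResidueDivisor n
    residue-divisor : ∀ {q} → Prime q → q ∣ n → q % 8 ≡ 1 ⊎ q % 8 ≡ 7 → SquareOrResidueDivisor n

  SquareOrResidueDivisor-* : ∀ m {n} → SquareOrResidueDivisor n → SquareOrResidueDivisor (m * n)
  SquareOrResidueDivisor-* m (square-divisor 1<q q²∣n)         = square-divisor 1<q (∣n⇒∣m*n m q²∣n)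
  SquareOrResidueDivisor-* m (residue-divisor q-prime q∣n q%8) = residue-divisor q-prime (∣n⇒∣m*n m q∣n) q%8

  goodPrimes-or-divisor : ∀ ps → All Prime ps → ¬ 2 ∣ product ps →
                          GoodPrimes ps ⊎ SquareOrResidueDivisor (product ps)
  goodPrimes-or-divisor []       []                  _   = inj₁ ([] , [] , [])
  goodPrimes-or-divisor (q ∷ ps) (q-prime ∷ ps-prime) odd
    with goodPrimes-or-divisor ps ps-prime (odd ∘ ∣n⇒∣m*n q)
  ... | inj₂ divisor = inj₂ (SquareOrResidueDivisor-* q divisor)
  ... | inj₁ (distinct , primes , ±3s) with (q % 8 ≟ 3) ⊎-dec (q % 8 ≟ 5)
  ...   | no not±3 = inj₂ (residue-divisor q-prime (m∣m*n _) (odd-residue-mod-8 q q-odd not±3))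
    where
    q-odd : ¬ 2 ∣ q
    q-odd 2∣q = odd (∣-trans 2∣q (m∣m*n _))
  ...   | yes ±3 with q ∈? ps
  ...     | yes q∈ps =
    inj₂ (square-divisor (PrimeModulus.1<p q q-prime) (*-monoʳ-∣ q (∈⇒∣product q∈ps)))
  ...     | no  q∉ps = inj₁ (¬Any⇒All¬ ps q∉ps ∷ distinct , q-prime ∷ primes , ±3 ∷ ±3s)

  goodFactorisation-or-divisor : ∀ n .{{_ : NonZero n}} → ¬ 2 ∣ n →
                           (∃ λ ps → GoodPrimes ps × n ≡ product ps) ⊎ SquareOrResidueDivisor n
  goodFactorisation-or-divisor n odd =
    Sum.map (λ good → factors , good , isFactorisation) (subst SquareOrResidueDivisor (sym isFactorisation))
      (goodPrimes-or-divisor factors factorsPrime (subst (¬_ ∘ (2 ∣_)) isFactorisation odd))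
    where open PrimeFactorisation (factorise n)

module Solutions where

  open import Data.Nat as ℕ using (suc; _<_; z≤n; s≤s; NonZero)
  open import Data.Nat.Properties as ℕ using (m*n≢0⇒m≢0)
  import Data.Nat.Divisibility as ℕ
  open import Data.Nat.DivMod using (m%n<n; m≡m%n+[m/n]*n)
  open import Data.Nat.Primality using (prime?)
  import Data.Nat.Tactic.RingSolver as ℕ-Solver
  open import Data.Integer using (1ℤ; -1ℤ; _+_; _-_; -_) renaming (_*_ to _*ℤ_)
  open import Data.Integer.Properties using (pos-*; pos-+; +-identityʳ; *-identityʳ; *-assoc)
  open import Data.Integer.Divisibility.Signed
    using (_∣_; divides; ∣⇒∣ᵤ; ∣ᵤ⇒∣; *-cancelˡ-∣; ∣m⇒∣m*n; ∣n⇒∣m*n)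
  open import Data.Integer.Tactic.RingSolver using (solve-∀)
  open import Data.Product using (_,_; proj₁; proj₂)
  open import Data.Sum using (_⊎_)
  open import Data.Empty using (⊥-elim)
  open import Relation.Nullary.Decidable using (from-yes)
  open import Relation.Binary.PropositionalEquality
    using (refl; sym; trans; cong; cong₂; subst; subst₂; module ≡-Reasoning)
  open NatArithmetic using (3<residue-prime)
  open Factorisation

  Solvable : ℕ → ℤ → Set
  Solvable v t = ∃ λ α → ∃ λ β →
    ¬ (α ≡ 0ℤ [mod v ]) × ¬ (β ≡ 0ℤ [mod v ]) × (form α β ≡ t [mod v ])

  ≡[mod]-of-multiple : ∀ {v} x t k → x - t ≡ k *ℤ + v → x ≡ t [mod v ]
  ≡[mod]-of-multiple x t k x-t≡kv = ∣⇒∣ᵤ (divides k x-t≡kv)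

  nonZero-factor : ∀ {v a b} → v ≡ a ℕ.* b → .{{NonZero v}} → NonZero a
  nonZero-factor {a = a} refl = m*n≢0⇒m≢0 a

  *≢0[mod] : ∀ {v} a c s → v ≡ a ℕ.* c → .{{NonZero a}} → ¬ (+ c ∣ s) →
             ¬ ((+ a *ℤ s) ≡ 0ℤ [mod v ])
  *≢0[mod] a c s refl c∤s v∣as =
    c∤s (*-cancelˡ-∣ (+ a) (subst₂ _∣_ (pos-* a c) (+-identityʳ (+ a *ℤ s)) (∣ᵤ⇒∣ v∣as)))

  ≢0[mod] : ∀ {v} a c → v ≡ a ℕ.* c → .{{NonZero a}} → 1 < c → ¬ ((+ a) ≡ 0ℤ [mod v ])
  ≢0[mod] {v} a c v≡ac 1<c a≡0 =
    *≢0[mod] a c 1ℤ v≡ac c∤1 (subst (λ x → x ≡ 0ℤ [mod v ]) (sym (*-identityʳ (+ a))) a≡0)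
    where
    c∤1 : ¬ (+ c ∣ 1ℤ)
    c∤1 c∣1 = ℕ.<⇒≢ 1<c (sym (ℕ.∣1⇒≡1 (∣⇒∣ᵤ c∣1)))

  square-divisor⇒solvable : ∀ {v q} .{{_ : NonZero v}} → 1 < q → q ℕ.* q ℕ.∣ v → Solvable v 0ℤ
  square-divisor⇒solvable {v} {q} 1<q (ℕ.divides e v≡e*q²) =
    + d , + d , d≢0 , d≢0 , ≡[mod]-of-multiple (form (+ d) (+ d)) 0ℤ (+ e) (begin
      form (+ d) (+ d) - 0ℤ   ≡⟨ identity (+ d) ⟩
      + d *ℤ + d              ≡⟨ trans (sym (pos-* d d)) (cong +_ d²≡e*v) ⟩
      + (e ℕ.* v)             ≡⟨ pos-* e v ⟩
      + e *ℤ + v              ∎)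
    where
    open ≡-Reasoning
    identity : ∀ x → + 2 *ℤ (x *ℤ x) - x *ℤ x - 0ℤ ≡ x *ℤ x
    identity = solve-∀
    d = e ℕ.* q
    v≡d*q : v ≡ d ℕ.* q
    v≡d*q = trans v≡e*q² (sym (ℕ.*-assoc e q q))
    instance
      d-nonZero : NonZero d
      d-nonZero = nonZero-factor v≡d*q
    d≢0 : ¬ ((+ d) ≡ 0ℤ [mod v ])
    d≢0 = ≢0[mod] d q v≡d*q 1<q
    d²≡e*v : d ℕ.* d ≡ e ℕ.* v
    d²≡e*v = trans (regroup e q) (cong (e ℕ.*_) (sym v≡e*q²))
      where
      regroup : ∀ e q → e ℕ.* q ℕ.* (e ℕ.* q) ≡ e ℕ.* (e ℕ.* (q ℕ.* q))
      regroup = ℕ-Solver.solve-∀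

  module ResidueDivisor {q} (q-prime : Prime q) (q%8 : q % 8 ≡ 1 ⊎ q % 8 ≡ 7) where

    module Q = PrimeModulus q q-prime
    open Q
    open TwoIsSquare q q-prime using (two-is-square)

    y : ℕ
    y = proj₁ (two-is-square q%8)

    y²≈2 : + y *ℤ + y ≈ + 2
    y²≈2 = proj₂ (two-is-square q%8)

    q∤y : ¬ (+ q ∣ + y)
    q∤y q∣y = positive-residue≉0 (s≤s z≤n) (ℕ.<⇒≤ (3<residue-prime q-prime q%8)) (begin
      + 2            ≈⟨ y²≈2 ⟨
      + y *ℤ + y     ≈⟨ *-cong (∣⇒≈0 q∣y) (∣⇒≈0 q∣y) ⟩
      0ℤ             ∎)
      where open ≈-Reasoning

  residue-divisor⇒solvable : ∀ {v q} .{{_ : NonZero v}} → Prime q → q ℕ.∣ v →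
                             q % 8 ≡ 1 ⊎ q % 8 ≡ 7 → Solvable v 0ℤ
  residue-divisor⇒solvable {v} {q} q-prime (ℕ.divides d v≡d*q) q%8 =
    α , β , ≢0[mod] d q v≡d*q Q.1<p , *≢0[mod] d q (+ y) v≡d*q q∤y ,
    ≡[mod]-of-multiple (form α β) 0ℤ (- (+ d *ℤ F)) (begin
      form α β - 0ℤ                            ≡⟨ factor (+ d) (+ y) ⟩
      - (+ d *ℤ + d) *ℤ (+ y *ℤ + y - + 2)     ≡⟨ cong (λ t → - (+ d *ℤ + d) *ℤ t) y²-2≡F*q ⟩
      - (+ d *ℤ + d) *ℤ (F *ℤ + q)             ≡⟨ regroup (+ d) F (+ q) ⟩
      - (+ d *ℤ F) *ℤ (+ d *ℤ + q)             ≡⟨ cong (λ t → - (+ d *ℤ F) *ℤ t) +v≡ ⟨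
      - (+ d *ℤ F) *ℤ + v                      ∎)
    where
    open ≡-Reasoning
    open ResidueDivisor q-prime q%8
    α = + d
    β = + d *ℤ + y
    +v≡ : + v ≡ + d *ℤ + q
    +v≡ = trans (cong +_ v≡d*q) (pos-* d q)
    instance
      d-nonZero : NonZero d
      d-nonZero = nonZero-factor v≡d*q
    q∣y²-2 = Q.modulus∣difference y²≈2
    F = _∣_.quotient q∣y²-2
    y²-2≡F*q : + y *ℤ + y - + 2 ≡ F *ℤ + q
    y²-2≡F*q = _∣_.equality q∣y²-2
    factor : ∀ d y → + 2 *ℤ (d *ℤ d) - (d *ℤ y) *ℤ (d *ℤ y) - 0ℤ
                     ≡ - (d *ℤ d) *ℤ (y *ℤ y - + 2)
    factor = solve-∀
    regroup : ∀ d f q → - (d *ℤ d) *ℤ (f *ℤ q) ≡ - (d *ℤ f) *ℤ (d *ℤ q)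
    regroup = solve-∀

  module ThreeTimesSquare {v w u r} (v≡ : v ≡ 3 ℕ.* (w ℕ.* w) ℕ.* u) .{{_ : NonZero v}}
                          (u%3≡r : u % 3 ≡ r) where

    W = + w
    T = + (u ℕ./ 3)
    U = + r + T *ℤ + 3

    +u≡ : + u ≡ U
    +u≡ = begin
      + u                          ≡⟨ cong +_ (m≡m%n+[m/n]*n u 3) ⟩
      + (u % 3 ℕ.+ u ℕ./ 3 ℕ.* 3)  ≡⟨ cong (λ x → + (x ℕ.+ u ℕ./ 3 ℕ.* 3)) u%3≡r ⟩
      + (r ℕ.+ u ℕ./ 3 ℕ.* 3)      ≡⟨ pos-+ r _ ⟩
      + r + + (u ℕ./ 3 ℕ.* 3)      ≡⟨ cong (λ x → + r + x) (pos-* (u ℕ./ 3) 3) ⟩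
      U                            ∎
      where open ≡-Reasoning

    +wu≡ : + (w ℕ.* u) ≡ W *ℤ U
    +wu≡ = trans (pos-* w u) (cong (W *ℤ_) +u≡)

    +w²u≡ : + (w ℕ.* w ℕ.* u) ≡ W *ℤ W *ℤ U
    +w²u≡ = trans (pos-* (w ℕ.* w) u) (cong₂ _*ℤ_ (pos-* w w) +u≡)

    +v≡ : + v ≡ + 3 *ℤ (W *ℤ W) *ℤ U
    +v≡ = trans (cong +_ v≡) (trans (pos-* (3 ℕ.* (w ℕ.* w)) u)
            (cong₂ _*ℤ_ (trans (pos-* 3 (w ℕ.* w)) (cong (+ 3 *ℤ_) (pos-* w w))) +u≡))

    instance
      wu-nonZero : NonZero (w ℕ.* u)
      wu-nonZero = nonZero-factor {b = 3 ℕ.* w} (trans v≡ (regroup w u))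
        where
        regroup : ∀ w u → 3 ℕ.* (w ℕ.* w) ℕ.* u ≡ w ℕ.* u ℕ.* (3 ℕ.* w)
        regroup = ℕ-Solver.solve-∀

  module _ {v} (w u : ℕ) (v≡ : v ≡ 3 ℕ.* (w ℕ.* w) ℕ.* u) .{{_ : NonZero v}} where

    private
      w-nonZero : NonZero w
      w-nonZero = nonZero-factor {b = 3 ℕ.* w ℕ.* u} (trans v≡ (regroup w u))
        where
        regroup : ∀ w u → 3 ℕ.* (w ℕ.* w) ℕ.* u ≡ w ℕ.* (3 ℕ.* w ℕ.* u)
        regroup = ℕ-Solver.solve-∀

    three-square-1⇒solvable : u % 3 ≡ 1 → Solvable v (+ (w ℕ.* w ℕ.* u))
    three-square-1⇒solvable u%3≡1 =
      α , α , α≢0 , α≢0 , ≡[mod]-of-multiple (form α α) (+ (w ℕ.* w ℕ.* u)) T (begin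
        form α α - + (w ℕ.* w ℕ.* u)                         ≡⟨ cong₂ _-_ (cong₂ form +wu≡ +wu≡) +w²u≡ ⟩
        form (W *ℤ U) (W *ℤ U) - W *ℤ W *ℤ U                ≡⟨ identity W T ⟩
        T *ℤ (+ 3 *ℤ (W *ℤ W) *ℤ U)                          ≡⟨ cong (T *ℤ_) +v≡ ⟨
        T *ℤ + v                                             ∎)
      where
      open ThreeTimesSquare {w = w} {u = u} v≡ u%3≡1
      open ≡-Reasoning
      α = + (w ℕ.* u)
      α≢0 : ¬ (α ≡ 0ℤ [mod v ])
      α≢0 = ≢0[mod] (w ℕ.* u) (3 ℕ.* w) (trans v≡ (regroup w u)) 1<3w
        where
        regroup : ∀ w u → 3 ℕ.* (w ℕ.* w) ℕ.* u ≡ w ℕ.* u ℕ.* (3 ℕ.* w)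
        regroup = ℕ-Solver.solve-∀
        1<3w : 1 < 3 ℕ.* w
        1<3w = ℕ.<-≤-trans (s≤s (s≤s z≤n)) (ℕ.m≤m*n 3 w {{w-nonZero}})
      identity : ∀ W T → let U = + 1 + T *ℤ + 3; α = W *ℤ U in
                 + 2 *ℤ (α *ℤ α) - α *ℤ α - W *ℤ W *ℤ U ≡ T *ℤ (+ 3 *ℤ (W *ℤ W) *ℤ U)
      identity = solve-∀

    three-square-2⇒solvable : u % 3 ≡ 2 → 1 < w → Solvable v (+ (w ℕ.* w ℕ.* u))
    three-square-2⇒solvable u%3≡2 1<w =
      α , β , α≢0 , β≢0 , ≡[mod]-of-multiple (form α β) (+ (w ℕ.* w ℕ.* u)) k (begin
        form α β - + (w ℕ.* w ℕ.* u)
          ≡⟨ cong₂ _-_ (cong₂ form +wu≡ +3wu≡) +w²u≡ ⟩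
        form (W *ℤ U) (+ 3 *ℤ (W *ℤ U)) - W *ℤ W *ℤ U  ≡⟨ identity W T ⟩
        k *ℤ (+ 3 *ℤ (W *ℤ W) *ℤ U)                     ≡⟨ cong (k *ℤ_) +v≡ ⟨
        k *ℤ + v                                        ∎)
      where
      open ThreeTimesSquare {w = w} {u = u} v≡ u%3≡2
      open ≡-Reasoning
      α = + (w ℕ.* u)
      β = + (3 ℕ.* (w ℕ.* u))
      k = - (+ 5 + + 7 *ℤ T)
      +3wu≡ : β ≡ + 3 *ℤ (W *ℤ U)
      +3wu≡ = trans (pos-* 3 (w ℕ.* u)) (cong (+ 3 *ℤ_) +wu≡)
      α≢0 : ¬ (α ≡ 0ℤ [mod v ])
      α≢0 = ≢0[mod] (w ℕ.* u) (3 ℕ.* w) (trans v≡ (regroup w u)) (ℕ.<-≤-trans 1<w (ℕ.m≤n*m w 3))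
        where
        regroup : ∀ w u → 3 ℕ.* (w ℕ.* w) ℕ.* u ≡ w ℕ.* u ℕ.* (3 ℕ.* w)
        regroup = ℕ-Solver.solve-∀
      β≢0 : ¬ (β ≡ 0ℤ [mod v ])
      β≢0 = ≢0[mod] (3 ℕ.* (w ℕ.* u)) w (trans v≡ (regroup w u)) {{ℕ.m*n≢0 3 (w ℕ.* u)}} 1<w
        where
        regroup : ∀ w u → 3 ℕ.* (w ℕ.* w) ℕ.* u ≡ 3 ℕ.* (w ℕ.* u) ℕ.* w
        regroup = ℕ-Solver.solve-∀
      identity : ∀ W T → let U = + 2 + T *ℤ + 3; α = W *ℤ U; β = + 3 *ℤ (W *ℤ U) in
                 + 2 *ℤ (α *ℤ α) - β *ℤ β - W *ℤ W *ℤ U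
                 ≡ - (+ 5 + + 7 *ℤ T) *ℤ (+ 3 *ℤ (W *ℤ W) *ℤ U)
      identity = solve-∀

  prime[3] : Prime 3
  prime[3] = from-yes (prime? 3)

  module Mod3 = PrimeModulus 3 prime[3]

  square≈1-mod-3 : ∀ {q} → ¬ 3 ℕ.∣ q → Mod3._≈_ (+ q *ℤ + q) 1ℤ
  square≈1-mod-3 {q} 3∤q with q % 3 in q%3≡ | m%n<n q 3
  ... | 0 | _ = ⊥-elim (3∤q (ℕ.m%n≡0⇒n∣m q 3 q%3≡))
  ... | 1 | _ = Mod3.*-cong q≈r q≈r
    where q≈r = subst (λ r → Mod3._≈_ (+ q) (+ r)) q%3≡ (Mod3.≈-residue (+ q))
  ... | 2 | _ = Mod3.≈-trans (Mod3.*-cong q≈r q≈r) (Mod3.mk (divides 1ℤ refl))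
    where q≈r = subst (λ r → Mod3._≈_ (+ q) (+ r)) q%3≡ (Mod3.≈-residue (+ q))
  ... | suc (suc (suc _)) | s≤s (s≤s (s≤s ()))

  quotient+1≈0-mod-3 : ∀ {u d q} F s → u ≡ d ℕ.* q → u % 3 ≡ 2 → ¬ 3 ℕ.∣ q →
                       + d *ℤ (+ 9 *ℤ (s *ℤ s) - + 2) ≡ F *ℤ + q → Mod3._≈_ (F + 1ℤ) 0ℤ
  quotient+1≈0-mod-3 {u} {d} {q} F s u≡dq u%3≡2 3∤q d[9s²-2]≡Fq = begin
    F + 1ℤ                                          ≡⟨ cong (_+ 1ℤ) (*-identityʳ F) ⟨
    F *ℤ 1ℤ + 1ℤ
      ≈⟨ +-cong (*-cong (≈-refl {F}) (square≈1-mod-3 3∤q)) (≈-refl {1ℤ}) ⟨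
    F *ℤ (+ q *ℤ + q) + 1ℤ                          ≡⟨ cong (_+ 1ℤ) (*-assoc F (+ q) (+ q)) ⟨
    F *ℤ + q *ℤ + q + 1ℤ                            ≡⟨ cong (λ x → x *ℤ + q + 1ℤ) d[9s²-2]≡Fq ⟨
    + d *ℤ (+ 9 *ℤ (s *ℤ s) - + 2) *ℤ + q + 1ℤ      ≡⟨ cong (_+ 1ℤ) (regroup (+ d) (+ q) s) ⟩
    + d *ℤ + q *ℤ ((s *ℤ s) *ℤ + 3 *ℤ + 3 - + 2) + 1ℤ
      ≈⟨ +-cong (*-cong dq≈2 (+-cong (multiple≈0 (s *ℤ s *ℤ + 3)) (≈-refl { - + 2})))
                (≈-refl {1ℤ}) ⟩
    + 2 *ℤ (0ℤ - + 2) + 1ℤ                          ≈⟨ multiple≈0 -1ℤ ⟩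
    0ℤ                                              ∎
    where
    open Mod3
    open ≈-Reasoning
    regroup : ∀ d q s → d *ℤ (+ 9 *ℤ (s *ℤ s) - + 2) *ℤ q
                        ≡ d *ℤ q *ℤ ((s *ℤ s) *ℤ + 3 *ℤ + 3 - + 2)
    regroup = solve-∀
    dq≈2 : + d *ℤ + q ≈ + 2
    dq≈2 = ≈-trans (≈-reflexive (trans (sym (pos-* d q)) (cong +_ (sym u≡dq))))
                   (subst (λ r → + u ≈ + r) u%3≡2 (≈-residue (+ u)))

  three-times⇒solvable : ∀ {v u d q} → v ≡ 3 ℕ.* u → u ≡ d ℕ.* q → .{{_ : NonZero v}} →
                         u % 3 ≡ 2 → ¬ 3 ℕ.∣ q → 1 < q → (s : ℤ) →
                         + q ∣ + d *ℤ (+ 9 *ℤ (s *ℤ s) - + 2) → ¬ (+ q ∣ s) → Solvable v (+ u)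
  three-times⇒solvable {v} {u} {d} {q} v≡3u u≡dq u%3≡2 3∤q 1<q s q∣d[9s²-2] q∤s =
    + d , β , α≢0 , β≢0 , ≡[mod]-of-multiple (form (+ d) β) (+ u) (- G) (begin
      form (+ d) β - + u                                 ≡⟨ cong₂ _-_ (cong (form (+ d)) β≡) +u≡ ⟩
      form D (+ 3 *ℤ D *ℤ s) - D *ℤ Q                    ≡⟨ expand D Q s ⟩
      - D *ℤ (D *ℤ (+ 9 *ℤ (s *ℤ s) - + 2)) - D *ℤ Q     ≡⟨ cong (λ x → - D *ℤ x - D *ℤ Q) F-eq ⟩
      - D *ℤ (F *ℤ Q) - D *ℤ Q                           ≡⟨ collect D Q F ⟩
      - (F + 1ℤ) *ℤ (D *ℤ Q)                             ≡⟨ cong (λ x → - x *ℤ (D *ℤ Q)) G-eq ⟩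
      - (G *ℤ + 3) *ℤ (D *ℤ Q)                           ≡⟨ regroup G D Q ⟩
      - G *ℤ (+ 3 *ℤ (D *ℤ Q))                           ≡⟨ cong (λ x → - G *ℤ (+ 3 *ℤ x)) +u≡ ⟨
      - G *ℤ (+ 3 *ℤ + u)                                ≡⟨ cong (λ x → - G *ℤ x) +v≡ ⟨
      - G *ℤ + v                                         ∎)
    where
    open ≡-Reasoning
    D = + d
    Q = + q
    β = + (3 ℕ.* d) *ℤ s
    β≡ : β ≡ + 3 *ℤ D *ℤ s
    β≡ = cong (_*ℤ s) (pos-* 3 d)
    +u≡ : + u ≡ D *ℤ Q
    +u≡ = trans (cong +_ u≡dq) (pos-* d q)
    +v≡ : + v ≡ + 3 *ℤ + u
    +v≡ = trans (cong +_ v≡3u) (pos-* 3 u)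
    v≡d*3q : v ≡ d ℕ.* (3 ℕ.* q)
    v≡d*3q = trans v≡3u (trans (cong (3 ℕ.*_) u≡dq) (regroup-ℕ d q))
      where
      regroup-ℕ : ∀ d q → 3 ℕ.* (d ℕ.* q) ≡ d ℕ.* (3 ℕ.* q)
      regroup-ℕ = ℕ-Solver.solve-∀
    instance
      d-nonZero : NonZero d
      d-nonZero = nonZero-factor v≡d*3q
    α≢0 : ¬ ((+ d) ≡ 0ℤ [mod v ])
    α≢0 = ≢0[mod] d (3 ℕ.* q) v≡d*3q (ℕ.<-≤-trans 1<q (ℕ.m≤n*m q 3))
    β≢0 : ¬ (β ≡ 0ℤ [mod v ])
    β≢0 = *≢0[mod] (3 ℕ.* d) q s (trans v≡3u (trans (cong (3 ℕ.*_) u≡dq) (sym (ℕ.*-assoc 3 d q))))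
                   {{ℕ.m*n≢0 3 d}} q∤s
    F = _∣_.quotient q∣d[9s²-2]
    F-eq : D *ℤ (+ 9 *ℤ (s *ℤ s) - + 2) ≡ F *ℤ Q
    F-eq = _∣_.equality q∣d[9s²-2]
    3∣F+1 = Mod3.≈0⇒∣ (quotient+1≈0-mod-3 {d = d} F s u≡dq u%3≡2 3∤q F-eq)
    G = _∣_.quotient 3∣F+1
    G-eq : F + 1ℤ ≡ G *ℤ + 3
    G-eq = _∣_.equality 3∣F+1
    expand : ∀ D Q s → + 2 *ℤ (D *ℤ D) - (+ 3 *ℤ D *ℤ s) *ℤ (+ 3 *ℤ D *ℤ s) - D *ℤ Q
                       ≡ - D *ℤ (D *ℤ (+ 9 *ℤ (s *ℤ s) - + 2)) - D *ℤ Q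
    expand = solve-∀
    collect : ∀ D Q F → - D *ℤ (F *ℤ Q) - D *ℤ Q ≡ - (F + 1ℤ) *ℤ (D *ℤ Q)
    collect = solve-∀
    regroup : ∀ G D Q → - (G *ℤ + 3) *ℤ (D *ℤ Q) ≡ - G *ℤ (+ 3 *ℤ (D *ℤ Q))
    regroup = solve-∀

  divisor⇒three-times-solvable : ∀ {v u} → v ≡ 3 ℕ.* u → .{{_ : NonZero v}} → u % 3 ≡ 2 →
                                 ¬ 3 ℕ.∣ u → SquareOrResidueDivisor u → Solvable v (+ u)
  divisor⇒three-times-solvable {v} {u} v≡3u u%3≡2 3∤u (square-divisor {q} 1<q (ℕ.divides e u≡e*q²)) =
    three-times⇒solvable {d = e ℕ.* q} v≡3u u≡dq u%3≡2 3∤q 1<q 1ℤ (∣m⇒∣m*n _ q∣d) q∤1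
    where
    q∣d : + q ∣ + (e ℕ.* q)
    q∣d = ∣ᵤ⇒∣ (ℕ.divides e refl)
    u≡dq : u ≡ e ℕ.* q ℕ.* q
    u≡dq = trans u≡e*q² (sym (ℕ.*-assoc e q q))
    3∤q : ¬ 3 ℕ.∣ q
    3∤q 3∣q = 3∤u (ℕ.∣-trans 3∣q (ℕ.divides (e ℕ.* q) u≡dq))
    q∤1 : ¬ (+ q ∣ 1ℤ)
    q∤1 q∣1 = ℕ.<⇒≢ 1<q (sym (ℕ.∣1⇒≡1 (∣⇒∣ᵤ q∣1)))
  divisor⇒three-times-solvable {v} {u} v≡3u u%3≡2 3∤u
                               (residue-divisor {q} q-prime q∣u@(ℕ.divides d u≡dq) q%8) =
    three-times⇒solvable {d = d} v≡3u u≡dq u%3≡2 3∤q 1<p s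
                         (∣n⇒∣m*n (+ d) (≈0⇒∣ (≈⇒-≈0 9s²≈2))) q∤s
    where
    open ResidueDivisor q-prime q%8
    open Q
    open ≈-Reasoning
    3<q = 3<residue-prime q-prime q%8
    3∤q : ¬ 3 ℕ.∣ q
    3∤q 3∣q = 3∤u (ℕ.∣-trans 3∣q q∣u)
    t = proj₁ (inverse (+ 3) (positive-residue≉0 (s≤s z≤n) 3<q))
    3t≈1 : + 3 *ℤ t ≈ 1ℤ
    3t≈1 = proj₂ (inverse (+ 3) (positive-residue≉0 (s≤s z≤n) 3<q))
    s = t *ℤ + y
    9s²≈2 : + 9 *ℤ (s *ℤ s) ≈ + 2
    9s²≈2 = begin
      + 9 *ℤ (s *ℤ s)                    ≡⟨ regroup t (+ y) ⟩
      (+ 3 *ℤ t) *ℤ (+ 3 *ℤ t) *ℤ (+ y *ℤ + y)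
        ≈⟨ *-cong (*-cong 3t≈1 3t≈1) y²≈2 ⟩
      + 2                                ∎
      where
      regroup : ∀ t y → + 9 *ℤ ((t *ℤ y) *ℤ (t *ℤ y)) ≡ (+ 3 *ℤ t) *ℤ (+ 3 *ℤ t) *ℤ (y *ℤ y)
      regroup = solve-∀
    q∤s : ¬ (+ q ∣ s)
    q∤s q∣s = positive-residue≉0 (s≤s z≤n) (ℕ.<⇒≤ 3<q) (begin
      + 2                ≈⟨ 9s²≈2 ⟨
      + 9 *ℤ (s *ℤ s)    ≈⟨ *-cong (≈-refl {+ 9}) (*-cong (∣⇒≈0 q∣s) (∣⇒≈0 q∣s)) ⟩
      + 9 *ℤ 0ℤ          ∎)

module Cases where

  open import Data.Nat as ℕ using (zero; suc; _*_; _^_; _<_; z≤n; s≤s; NonZero)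
  open import Data.Nat.Properties as ℕ using (^-*-assoc; *-identityˡ)
  open import Data.Nat.DivMod using (m%n<n; m*n/n≡m)
  open import Data.Nat.Divisibility as ℕ using (_∣_; _∣?_; divides; m%n≡0⇒n∣m; *-monoˡ-∣)
  import Data.Nat.Tactic.RingSolver as ℕ-Solver
  open import Data.Product using (_,_)
  open import Data.Sum using (inj₁; inj₂)
  open import Data.Empty using (⊥-elim)
  open import Relation.Nullary using (yes; no)
  open import Relation.Binary.PropositionalEquality using (refl; sym; trans; cong; cong₂; subst)
  open NatArithmetic
  open Factorisation
  open Solutions

  divisor⇒solvable : ∀ {v} .{{_ : NonZero v}} → SquareOrResidueDivisor v → Solvable v 0ℤ
  divisor⇒solvable (square-divisor 1<q q²∣v)          = square-divisor⇒solvable 1<q q²∣v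
  divisor⇒solvable (residue-divisor q-prime q∣v q%8) = residue-divisor⇒solvable q-prime q∣v q%8

  9^a≡3^a*3^a : ∀ a → 9 ^ a ≡ 3 ^ a * 3 ^ a
  9^a≡3^a*3^a zero    = refl
  9^a≡3^a*3^a (suc a) = trans (cong (9 *_) (9^a≡3^a*3^a a)) (regroup (3 ^ a))
    where
    regroup : ∀ x → 9 * (x * x) ≡ 3 * x * (3 * x)
    regroup = ℕ-Solver.solve-∀

  three-square⇒solvable : ∀ {v} a u → .{{_ : NonZero v}} → v ≡ 3 * (3 ^ a * 3 ^ a) * u → ¬ 3 ∣ u →
                          v % 12 ≡ 3 → ¬ ExcII v → Solvable v (+ (3 ^ a * 3 ^ a * u))
  three-square⇒solvable a u v≡ 3∤u v%12≡3 ¬II with u % 3 in u%3≡ | m%n<n u 3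
  ... | 0 | _ = ⊥-elim (3∤u (m%n≡0⇒n∣m u 3 u%3≡))
  ... | 1 | _ = three-square-1⇒solvable (3 ^ a) u v≡ u%3≡
  three-square⇒solvable (suc a) u v≡ 3∤u v%12≡3 ¬II | 2 | _ =
    three-square-2⇒solvable (3 ^ suc a) u v≡ u%3≡ (ℕ.^-monoʳ-< 3 (s≤s (s≤s z≤n)) {0} {suc a} (s≤s z≤n))
  three-square⇒solvable {v} zero u v≡ 3∤u v%12≡3 ¬II | 2 | _
    with goodFactorisation-or-divisor u {{u-nonZero}} u-odd
    where
    u-nonZero : NonZero u
    u-nonZero = nonZero-factor {b = 3} (trans v≡ (ℕ.*-comm 3 u))
    u-odd : ¬ 2 ∣ u
    u-odd 2∣u =
      odd-of-residue (divides 6 refl) v%12≡3 refl (subst (2 ∣_) (sym v≡) (ℕ.∣n⇒∣m*n 3 2∣u))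
  ... | inj₁ (ps , good , u≡) =
    ⊥-elim (¬II (mod-36-of-3u {u = u} v≡ u%3≡ v%12≡3 , ps , good , trans v≡ (cong (3 *_) u≡)))
  ... | inj₂ divisor =
    subst (λ n → Solvable v (+ n)) (sym (*-identityˡ u))
          (divisor⇒three-times-solvable v≡ u%3≡ 3∤u divisor)
  three-square⇒solvable _ _ _ _ _ _ | suc (suc (suc _)) | s≤s (s≤s (s≤s ()))

  3-mod-12⇒solvable : ∀ {v} .{{_ : NonZero v}} → v % 12 ≡ 3 → ¬ ExcI v → ¬ ExcII v → Solvable v (+ (v / 3))
  3-mod-12⇒solvable {v} v%12≡3 ¬I ¬II with factor-out-power 9 (s≤s (s≤s z≤n)) (ℕ.≢-nonZero⁻¹ v)
  ... | a , v₁ , v≡9^a*v₁ , 9∤v₁ with 3 ∣? v₁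
  ...   | no 3∤v₁ = ⊥-elim (¬I (v%12≡3 , a , v₁ , exponent-positive v≡9^a*v₁ , 3∤v₁ , v≡3^[2a]*v₁))
    where
    3∣v : 3 ∣ v
    3∣v = m%n≡0⇒n∣m v 3 (%-divisor 3 12 v (divides 4 refl) v%12≡3)
    exponent-positive : ∀ {a} → v ≡ 9 ^ a * v₁ → 1 ℕ.≤ a
    exponent-positive {zero}  v≡1*v₁ = ⊥-elim (3∤v₁ (subst (3 ∣_) (trans v≡1*v₁ (*-identityˡ v₁)) 3∣v))
    exponent-positive {suc _} _      = s≤s z≤n
    v≡3^[2a]*v₁ : v ≡ 3 ^ (2 * a) * v₁
    v≡3^[2a]*v₁ = trans v≡9^a*v₁ (cong (_* v₁) (^-*-assoc 3 2 a))
  ...   | yes (divides u v₁≡u*3) =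
    subst (λ n → Solvable v (+ n)) (sym v/3≡) (three-square⇒solvable a u v≡ 3∤u v%12≡3 ¬II)
    where
    3∤u : ¬ 3 ∣ u
    3∤u 3∣u = 9∤v₁ (subst (9 ∣_) (sym v₁≡u*3) (*-monoˡ-∣ 3 3∣u))
    v≡ : v ≡ 3 * (3 ^ a * 3 ^ a) * u
    v≡ = trans v≡9^a*v₁ (trans (cong₂ _*_ (9^a≡3^a*3^a a) v₁≡u*3) (regroup (3 ^ a) u))
      where
      regroup : ∀ w u → w * w * (u * 3) ≡ 3 * (w * w) * u
      regroup = ℕ-Solver.solve-∀
    v/3≡ : v / 3 ≡ 3 ^ a * 3 ^ a * u
    v/3≡ = trans (cong (_/ 3) (trans v≡ (regroup (3 ^ a) u))) (m*n/n≡m (3 ^ a * 3 ^ a * u) 3)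
      where
      regroup : ∀ w u → 3 * (w * w) * u ≡ w * w * u * 3
      regroup = ℕ-Solver.solve-∀

  7-or-11-mod-12⇒solvable : ∀ {v} .{{_ : NonZero v}} → v % 4 ≡ 3 → Is7or11Mod12 v → ¬ ExcIII v →
                            Solvable v 0ℤ
  7-or-11-mod-12⇒solvable {v} v%4≡3 v%12 ¬III
    with goodFactorisation-or-divisor v (odd-of-residue (divides 2 refl) v%4≡3 refl)
  ... | inj₁ (ps , good , v≡) = ⊥-elim (¬III (v%12 , ps , good , v≡))
  ... | inj₂ divisor          = divisor⇒solvable divisor

proposition3p4 : (v : ℕ) → v % 4 ≡ 3 → ¬ ExcI v → ¬ ExcII v → ¬ ExcIII v →
    ((v % 12 ≡ 3 → ∃ λ (α : ℤ) → ∃ λ (β : ℤ) →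
        ¬ (α ≡ 0ℤ [mod v ]) × ¬ (β ≡ 0ℤ [mod v ]) × (form α β ≡ + (v / 3) [mod v ]))
    × (Is7or11Mod12 v → ∃ λ (α : ℤ) → ∃ λ (β : ℤ) →
        ¬ (α ≡ 0ℤ [mod v ]) × ¬ (β ≡ 0ℤ [mod v ]) × (form α β ≡ 0ℤ [mod v ])))
proposition3p4 zero    ()
proposition3p4 (suc _) v%4≡3 ¬I ¬II ¬III =
  (λ v%12≡3 → 3-mod-12⇒solvable v%12≡3 ¬I ¬II) , (λ v%12 → 7-or-11-mod-12⇒solvable v%4≡3 v%12 ¬III)
  where open Cases
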